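{- Let $\mathbf{k}$ be a commutative ring, $q\in\mathbf{k}$, $n\ge0$ and $I\subseteq[n-1]$. Then \[L^{(q)}_I=\sum_{\substack{J\subseteq I\\ K\subseteq\operatorname{Peak}(I)\\ J\cap K=\emptyset}}(-q)^{|K|}(q-1)^{|J|}\,\eta^{(q)}_{J\cup(K-1)\cup K}.\]
   Context: Let $x_1,x_2,\dots$ be commuting indeterminates, working in $\mathbf{k}[[x_1,x_2,\dots]]$. Let $\mathbb{P}=\{1,2,\dots\}$, $\mathbb{P}^{\pm}=\mathbb{P}\cup(-\mathbb{P})$ totally ordered by $-1<1<-2<2<\cdots$. For $\pi=\pi_1\cdots\pi_n\in S_n$, an enriched $P$-partition for the chain $\pi_1<_\pi\cdots<_\pi\pi_n$ is $f:[n]\to\mathbb{P}^{\pm}$ such that whenever $i<_\pi j$: if $i<j$ then $f(i)<f(j)$ or $f(i)=f(j)\in\mathbb{P}$, and if $i>j$ then $f(i)<f(j)$ or $f(i)=f(j)\in-\mathbb{P}$. The $q$-fundamental quasisymmetric function is $L^{(q)}_I=L^{(q)}_{n,I}=\sum_f\prod_{i=1}^n q^{[f(i)<0]}x_{|f(i)|}$ (sum over such $f$, $[f(i)<0]\in\{0,1\}$ indicating negativity) for any $\pi\in S_n$ with $\operatorname{Des}(\pi)=\{i:\pi(i)>\pi(i+1)\}=I$; it depends only on $n$ and $I$. $\operatorname{Peak}(I)=I\setminus(I+1)\setminus\{1\}$ with $I+1=\{i+1:i\in I\}$, and $K-1=\{k-1:k\in K\}$. For $A\subseteq[n-1]$,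 $\eta^{(q)}_A=\sum(q+1)^{|\{i_1,\dots,i_n\}|}x_{i_1}\cdots x_{i_n}$ over $i_1\le\cdots\le i_n$ with $j\in A\Rightarrow i_j=i_{j+1}$. -}

module Defs where

open import Level using (Level)
open import Algebra.Bundles using (CommutativeRing)
open import Data.Bool using (Bool; true; false; _∧_; _∨_; not; if_then_else_)
open import Data.Nat using (ℕ; zero; suc; _∸_; _<ᵇ_; _≡ᵇ_; _≤ᵇ_)
import Data.Nat as ℕ
open import Data.Fin using (Fin; toℕ)
open import Data.List.Base using (List; []; _∷_; map; foldr; concatMap; allFin; upTo; all; any)
open import Data.Product using (_×_; _,_; proj₁; proj₂)
open import Data.Fin.Permutation using (Permutation′; _⟨$⟩ʳ_)

allFuns : ∀ {a} {A : Set a} (n : ℕ) → List A → List (Fin n → A)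
allFuns zero    xs = (λ ()) ∷ []
allFuns (suc n) xs =
  concatMap (λ a → map (λ g → λ { Fin.zero → a ; (Fin.suc i) → g i }) (allFuns n xs)) xs

countB : ∀ {a} {A : Set a} → (A → Bool) → List A → ℕ
countB p xs = foldr (λ x r → if p x then suc r else r) 0 xs

Subset : Set
Subset = ℕ → Bool

-- all subsets of [m] = {1,…,m} (false outside [m])
subsetsOf[_] : ℕ → List Subset
subsetsOf[ zero ]  = (λ _ → false) ∷ []
subsetsOf[ suc m ] =
  concatMap (λ S → S ∷ (λ k → (k ≡ᵇ suc m) ∨ S k) ∷ []) subsetsOf[ m ]

range1 : ℕ → List ℕ
range1 m = map suc (upTo m)

card : ℕ → Subset → ℕ
card m S = countB S (range1 m)

subsetB : ℕ → Subset → Subset → Bool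
subsetB m S T = all (λ k → not (S k) ∨ T k) (range1 m)

disjointB : ℕ → Subset → Subset → Bool
disjointB m S T = all (λ k → not (S k ∧ T k)) (range1 m)

Peak : Subset → Subset
Peak I k = I k ∧ not ((1 ≤ᵇ k) ∧ I (k ∸ 1)) ∧ not (k ≡ᵇ 1)

shiftDown : Subset → Subset
shiftDown K k = K (suc k)

_∪_ : Subset → Subset → Subset
(S ∪ T) k = S k ∨ T k

-- Descent set of a permutation π ∈ S_n, in one-line notation
-- π_1 ⋯ π_n with π_i = π(i)  (1-indexed; Fin is 0-indexed)

nth : List ℕ → ℕ → ℕ
nth []       _       = 0
nth (x ∷ xs) zero    = x
nth (x ∷ xs) (suc i) = nth xs i

oneLine : ∀ {n} → Permutation′ n → List ℕ
oneLine {n} π = map (λ i → toℕ (π ⟨$⟩ʳ i)) (allFin n)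

Des : ∀ {n} → Permutation′ n → Subset
Des {n} π i = (1 ≤ᵇ i) ∧ (i <ᵇ n) ∧ (nth (oneLine π) i <ᵇ nth (oneLine π) (i ∸ 1))

-- Elements of ℙ^± with absolute value ≤ N: a pair (v , neg) with
-- v : Fin N standing for the absolute value v+1, neg = true iff negative.
-- Order -1 < 1 < -2 < 2 < ⋯ is encoded by key (v , neg) = 2v + [not neg].

PM : ℕ → Set
PM N = Fin N × Bool

key : ∀ {N} → PM N → ℕ
key (v , neg) = 2 ℕ.* toℕ v ℕ.+ (if neg then 0 else 1)

ltPM : ∀ {N} → PM N → PM N → Bool
ltPM x y = key x <ᵇ key y

eqPM : ∀ {N} → PM N → PM N → Bool
eqPM x y = key x ≡ᵇ key y

allPM : (N : ℕ) → List (PM N)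
allPM N = concatMap (λ v → (v , false) ∷ (v , true) ∷ []) (allFin N)

-- enriched P-partition condition for the chain π_1 <_π ⋯ <_π π_n:
-- for all positions a < b, with i = π_a, j = π_b (so i <_π j):
--   i < j ⇒ f(i) < f(j) or f(i) = f(j) ∈ ℙ
--   i > j ⇒ f(i) < f(j) or f(i) = f(j) ∈ -ℙ
isEnriched : ∀ {n N} → Permutation′ n → (Fin n → PM N) → Bool
isEnriched {n} π f =
  all (λ a → all (λ b →
    let i = π ⟨$⟩ʳ a ; j = π ⟨$⟩ʳ b in
    not (toℕ a <ᵇ toℕ b) ∨
      (if toℕ i <ᵇ toℕ j
        then ltPM (f i) (f j) ∨ (eqPM (f i) (f j) ∧ not (proj₂ (f i)))
        else ltPM (f i) (f j) ∨ (eqPM (f i) (f j) ∧ proj₂ (f i))))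
    (allFin n)) (allFin n)

-- A monomial in x_1,…,x_N is an exponent vector α : Fin N → ℕ
-- (α v = exponent of x_{v+1}).  A sequence s : Fin n → Fin N of indices
-- gives the monomial ∏_j x_{s j + 1}; hasExps tests whether it equals α.
hasExps : ∀ {n N} → (Fin n → Fin N) → (Fin N → ℕ) → Bool
hasExps {n} {N} s α =
  all (λ v → countB (λ j → toℕ (s j) ≡ᵇ toℕ v) (allFin n) ≡ᵇ α v) (allFin N)

module Coeffs {c ℓ : Level} (R : CommutativeRing c ℓ) where
  open CommutativeRing R

  sumR : List Carrier → Carrier
  sumR = foldr _+_ 0#

  pow : Carrier → ℕ → Carrier
  pow x zero    = 1#
  pow x (suc k) = x * pow x k

  -- Coefficient of x^α (α : Fin N → ℕ, a monomial in x_1,…,x_N) in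
  -- L^{(q)} defined through the permutation π:
  --   Σ_f ∏_i q^{[f(i)<0]} x_{|f(i)|}.
  -- Only f with all |f(i)| ≤ N can contribute to such a monomial.
  coeffL : (q : Carrier) {n : ℕ} → Permutation′ n → (N : ℕ) → (Fin N → ℕ) → Carrier
  coeffL q {n} π N α =
    sumR (map (λ f →
      if isEnriched π f ∧ hasExps (λ i → proj₁ (f i)) α
        then pow q (countB (λ i → proj₂ (f i)) (allFin n))
        else 0#)
      (allFuns n (allPM N)))

  -- Coefficient of x^α in η^{(q)}_A (A ⊆ [n-1]):
  --   Σ (q+1)^{|{i_1,…,i_n}|} x_{i_1}⋯x_{i_n}
  --   over i_1 ≤ ⋯ ≤ i_n with j ∈ A ⇒ i_j = i_{j+1}.
  -- Here i_{j} = s (j-1) + 1.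
  coeffEta : (q : Carrier) (n : ℕ) → Subset → (N : ℕ) → (Fin N → ℕ) → Carrier
  coeffEta q n A N α =
    sumR (map (λ s →
      let seq = map (λ j → toℕ (s j)) (allFin n) in
      if all (λ j → nth seq (j ∸ 1) ≤ᵇ nth seq j) (range1 (n ∸ 1))
         ∧ all (λ j → not (A j) ∨ (nth seq (j ∸ 1) ≡ᵇ nth seq j)) (range1 (n ∸ 1))
         ∧ hasExps s α
        then pow (q + 1#) (countB (λ v → any (λ j → toℕ (s j) ≡ᵇ toℕ v) (allFin n)) (allFin N))
        else 0#)
      (allFuns n (allFin N)))

  coeffRHS : (q : Carrier) (n : ℕ) → Subset → (N : ℕ) → (Fin N → ℕ) → Carrier
  coeffRHS q n I N α =
    sumR (map (λ J → sumR (map (λ K →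
      if subsetB (n ∸ 1) J I ∧ subsetB (n ∸ 1) K (Peak I) ∧ disjointB (n ∸ 1) J K
        then pow (- q) (card (n ∸ 1) K) * pow (q - 1#) (card (n ∸ 1) J)
               * coeffEta q n ((J ∪ shiftDown K) ∪ K) N α
        else 0#)
      subsetsOf[ n ∸ 1 ])) subsetsOf[ n ∸ 1 ])

-- Read along the chain, an enriched
-- P-partition f ∘ π splits into a sequence s of absolute values and a sequence of signs. Only
-- weakly increasing s contribute, and for such s the sum over the signs is computed link by
-- link: every block of equal values carries a factor q + 1, and inside a block a descent of π
-- contributes q, or 0 when it directly follows an ascent. On the other side η_A contributes
-- (q + 1)^(number of values of s) exactly when the positions in A are plateaus of s, so the
-- sum over J and K factorises into local sums 1 - q [j ∈ K] + (q - 1) [j ∈ J] over the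
-- positions j, and these take the same values.

module Submission where

open import Defs
open import Level using (Level; _⊔_)
open import Algebra.Bundles using (CommutativeRing)
open import Data.Bool using (Bool; true; false; _∧_; _∨_; _xor_; not; if_then_else_; T)
open import Data.Bool.Properties using (T-∧; T-∨; ∧-assoc; ∧-identityʳ; ∧-zeroʳ; not-involutive)
open import Data.Bool.ListAction using (all; any)
open import Data.Nat as ℕ using (ℕ; zero; suc; _<_; _≤_; _∸_; _<ᵇ_; _≡ᵇ_; _≤ᵇ_; z≤n; s≤s)
import Data.Nat.Properties as ℕₚ
open import Data.Nat.Tactic.RingSolver using (solve-∀)
open import Data.Fin using (Fin; toℕ; fromℕ<)
import Data.Fin.Properties as Finₚ
open import Data.Fin.Permutation using (Permutation′; _⟨$⟩ʳ_; _⟨$⟩ˡ_; flip; inverseˡ; remove; punchIn-permute)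
open import Data.List.Base using (List; []; _∷_; _++_; map; concatMap; allFin; tabulate; upTo)
import Data.List.Properties as Listₚ
open import Data.Vec.Functional using (insertAt) renaming (_∷_ to _◃_)
open import Data.Vec.Functional.Properties using (∷-cong; insertAt-lookup; insertAt-punchIn)
open import Data.Product using (_×_; _,_; proj₁; proj₂)
open import Data.Sum using (_⊎_; inj₁; inj₂)
open import Data.Unit using (tt)
open import Data.Empty using (⊥; ⊥-elim)
open import Function.Bundles using (Equivalence)
open import Relation.Binary.PropositionalEquality as ≡ using (_≡_; _≢_; cong; cong₂; subst)
import Relation.Binary.Reasoning.Setoid as SetoidReasoning
open import Algebra.Properties.CommutativeMonoid.Sum ℕₚ.+-0-commutativeMonoid using (sum; sum-permute)
import Algebra.Properties.CommutativeSemigroup as CommutativeSemigroupProperties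

open Equivalence using (to; from)

BoolFun : ℕ → Set
BoolFun zero    = Bool
BoolFun (suc k) = Bool → BoolFun k

everywhere : ∀ k → BoolFun k → Bool
everywhere zero    b = b
everywhere (suc k) p = everywhere k (p false) ∧ everywhere k (p true)

Valid : ∀ k → BoolFun k → Set
Valid zero    b = T b
Valid (suc k) p = ∀ x → Valid k (p x)

valid-by-evaluation : ∀ k (p : BoolFun k) → T (everywhere k p) → Valid k p
valid-by-evaluation zero    b t = t
valid-by-evaluation (suc k) p t false = valid-by-evaluation k (p false) (proj₁ (to T-∧ t))
valid-by-evaluation (suc k) p t true  = valid-by-evaluation k (p true) (proj₂ (to (T-∧ {everywhere k (p false)}) t))

modus-ponens : ∀ {a b} → T (not a ∨ b) → T a → T b
modus-ponens {true} t _ = t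

T⇒≡true : ∀ {a} → T a → a ≡ true
T⇒≡true {true} _ = ≡.refl

≡true⇒T : ∀ {a} → a ≡ true → T a
≡true⇒T ≡.refl = tt

T-⇔⇒≡ : ∀ {a b} → (T a → T b) → (T b → T a) → a ≡ b
T-⇔⇒≡ {true}  {true}  _ _ = ≡.refl
T-⇔⇒≡ {true}  {false} f _ = ⊥-elim (f tt)
T-⇔⇒≡ {false} {true}  _ g = ⊥-elim (g tt)
T-⇔⇒≡ {false} {false} _ _ = ≡.refl

¬T⇒≡false : ∀ {a} → (T a → ⊥) → a ≡ false
¬T⇒≡false {true}  f = ⊥-elim (f tt)
¬T⇒≡false {false} f = ≡.refl

T-not-xor⇒≡ : ∀ {a b} → T (not (a xor b)) → a ≡ b
T-not-xor⇒≡ {true}  {true}  _ = ≡.refl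
T-not-xor⇒≡ {false} {false} _ = ≡.refl

≡-by-evaluation : ∀ (f g : Bool → Bool → Bool → Bool → Bool → Bool) →
  T (everywhere 5 (λ a b c d e → not (f a b c d e xor g a b c d e))) → ∀ a b c d e → f a b c d e ≡ g a b c d e
≡-by-evaluation f g t a b c d e = T-not-xor⇒≡ (valid-by-evaluation 5 (λ a b c d e → not (f a b c d e xor g a b c d e)) t a b c d e)

true≢false : true ≢ false
true≢false ()

<⇒<ᵇ≡true : ∀ {m n} → m < n → (m <ᵇ n) ≡ true
<⇒<ᵇ≡true p = T⇒≡true (ℕₚ.<⇒<ᵇ p)

≤⇒<ᵇ≡false : ∀ {m n} → n ≤ m → (m <ᵇ n) ≡ false
≤⇒<ᵇ≡false {m} {n} p with m <ᵇ n in eq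
... | true  = ⊥-elim (ℕₚ.<⇒≱ (ℕₚ.<ᵇ⇒< m n (≡true⇒T eq)) p)
... | false = ≡.refl

<ᵇ≡true⇒< : ∀ {m n} → (m <ᵇ n) ≡ true → m < n
<ᵇ≡true⇒< {m} {n} e = ℕₚ.<ᵇ⇒< m n (≡true⇒T e)

<ᵇ≡false⇒≥ : ∀ {m n} → (m <ᵇ n) ≡ false → n ≤ m
<ᵇ≡false⇒≥ e = ℕₚ.≮⇒≥ (λ p → true≢false (≡.trans (≡.sym (<⇒<ᵇ≡true p)) e))

≡⇒≡ᵇ≡true : ∀ {m n} → m ≡ n → (m ≡ᵇ n) ≡ true
≡⇒≡ᵇ≡true {m} {n} e = T⇒≡true (ℕₚ.≡⇒≡ᵇ m n e)

≡ᵇ≡true⇒≡ : ∀ {m n} → (m ≡ᵇ n) ≡ true → m ≡ n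
≡ᵇ≡true⇒≡ {m} {n} e = ℕₚ.≡ᵇ⇒≡ m n (≡true⇒T e)

<ᵇ-flip : ∀ a b → a ≢ b → (b <ᵇ a) ≡ not (a <ᵇ b)
<ᵇ-flip a b a≢b with a <ᵇ b in eq
... | true  = ≤⇒<ᵇ≡false {b} {a} (ℕₚ.<⇒≤ (<ᵇ≡true⇒< {a} {b} eq))
... | false = <⇒<ᵇ≡true {b} {a} (ℕₚ.≤∧≢⇒< (<ᵇ≡false⇒≥ {a} {b} eq) (λ b≡a → a≢b (≡.sym b≡a)))

all-cong : ∀ {a} {A : Set a} {p q : A → Bool} (xs : List A) → (∀ x → p x ≡ q x) → all p xs ≡ all q xs
all-cong []       e = ≡.refl
all-cong (x ∷ xs) e = cong₂ _∧_ (e x) (all-cong xs e)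

all-map : ∀ {a b} {A : Set a} {B : Set b} (p : B → Bool) (f : A → B) (xs : List A) →
  all p (map f xs) ≡ all (λ x → p (f x)) xs
all-map p f []       = ≡.refl
all-map p f (x ∷ xs) = cong (p (f x) ∧_) (all-map p f xs)

all-++ : ∀ {a} {A : Set a} (p : A → Bool) (xs ys : List A) → all p (xs ++ ys) ≡ all p xs ∧ all p ys
all-++ p []       ys = ≡.refl
all-++ p (x ∷ xs) ys = ≡.trans (cong (p x ∧_) (all-++ p xs ys)) (≡.sym (∧-assoc (p x) (all p xs) (all p ys)))

all-∧ : ∀ {a} {A : Set a} (p q : A → Bool) (xs : List A) → all (λ x → p x ∧ q x) xs ≡ all p xs ∧ all q xs
all-∧ p q [] = ≡.refl
all-∧ p q (x ∷ xs) with p x | q x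
... | true  | true  = all-∧ p q xs
... | true  | false = ≡.sym (∧-zeroʳ (all p xs))
... | false | _     = ≡.refl

all-tabulate⁺ : ∀ {a} {A : Set a} {n} (f : Fin n → A) (p : A → Bool) → T (all p (tabulate f)) → ∀ i → T (p (f i))
all-tabulate⁺ f p t Fin.zero    = proj₁ (to T-∧ t)
all-tabulate⁺ f p t (Fin.suc i) = all-tabulate⁺ (λ j → f (Fin.suc j)) p (proj₂ (to (T-∧ {p (f Fin.zero)}) t)) i

all-tabulate⁻ : ∀ {a} {A : Set a} {n} (f : Fin n → A) (p : A → Bool) → (∀ i → T (p (f i))) → T (all p (tabulate f))
all-tabulate⁻ {n = zero}  f p h = tt
all-tabulate⁻ {n = suc n} f p h = from T-∧ (h Fin.zero , all-tabulate⁻ (λ j → f (Fin.suc j)) p (λ i → h (Fin.suc i)))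

count : ∀ {n} → (Fin n → Bool) → ℕ
count p = sum (λ i → if p i then 1 else 0)

countB-tabulate : ∀ {a} {A : Set a} {n} (p : A → Bool) (f : Fin n → A) →
  countB p (tabulate f) ≡ count (λ i → p (f i))
countB-tabulate {n = zero}  p f = ≡.refl
countB-tabulate {n = suc n} p f with p (f Fin.zero)
... | true  = cong suc (countB-tabulate p (λ i → f (Fin.suc i)))
... | false = countB-tabulate p (λ i → f (Fin.suc i))

count-cong : ∀ {n} {p q : Fin n → Bool} → (∀ i → p i ≡ q i) → count p ≡ count q
count-cong {zero}  e = ≡.refl
count-cong {suc n} e = cong₂ ℕ._+_ (cong (λ b → if b then 1 else 0) (e Fin.zero)) (count-cong (λ i → e (Fin.suc i)))

count-permute : ∀ {n} (p : Fin n → Bool) (σ : Permutation′ n) → count (λ i → p (σ ⟨$⟩ʳ i)) ≡ count p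
count-permute p σ = ≡.sym (sum-permute (λ i → if p i then 1 else 0) σ)

countB-++ : ∀ {a} {A : Set a} (p : A → Bool) (xs ys : List A) → countB p (xs ++ ys) ≡ countB p xs ℕ.+ countB p ys
countB-++ p []       ys = ≡.refl
countB-++ p (x ∷ xs) ys with p x
... | true  = cong suc (countB-++ p xs ys)
... | false = countB-++ p xs ys

range1-suc : ∀ m → range1 (suc m) ≡ range1 m ++ (suc m ∷ [])
range1-suc m = ≡.trans (cong (map suc) (≡.sym (Listₚ.upTo-∷ʳ m))) (Listₚ.map-++ suc (upTo m) (m ∷ []))

range1-suc-front : ∀ m → range1 (suc m) ≡ 1 ∷ map suc (range1 m)
range1-suc-front m = cong (λ l → 1 ∷ map suc l) (≡.sym (Listₚ.map-applyUpTo (λ i → i) suc m))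

all-range1-suc : ∀ (p : ℕ → Bool) m → all p (range1 (suc m)) ≡ all p (range1 m) ∧ p (suc m)
all-range1-suc p m = ≡.trans (cong (all p) (range1-suc m))
  (≡.trans (all-++ p (range1 m) (suc m ∷ [])) (cong (all p (range1 m) ∧_) (∧-identityʳ (p (suc m)))))

all-range1-suc-front : ∀ (p : ℕ → Bool) m → all p (range1 (suc m)) ≡ p 1 ∧ all (λ j → p (suc j)) (range1 m)
all-range1-suc-front p m = ≡.trans (cong (all p) (range1-suc-front m)) (cong (p 1 ∧_) (all-map p suc (range1 m)))

countB-range1-suc : ∀ (p : ℕ → Bool) m → countB p (range1 (suc m)) ≡ countB p (range1 m) ℕ.+ (if p (suc m) then 1 else 0)
countB-range1-suc p m = ≡.trans (cong (countB p) (range1-suc m)) (countB-++ p (range1 m) (suc m ∷ []))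

_≗[1,_]_ : (ℕ → Bool) → ℕ → (ℕ → Bool) → Set
p ≗[1, m ] q = ∀ k → 1 ≤ k → k ≤ m → p k ≡ q k

≗[1,suc]⇒≗[1,] : ∀ {p q} m → p ≗[1, suc m ] q → p ≗[1, m ] q
≗[1,suc]⇒≗[1,] m e k a b = e k a (ℕₚ.m≤n⇒m≤1+n b)

all-range1-cong : ∀ {p q} m → p ≗[1, m ] q → all p (range1 m) ≡ all q (range1 m)
all-range1-cong {p} {q} zero    e = ≡.refl
all-range1-cong {p} {q} (suc m) e rewrite all-range1-suc p m | all-range1-suc q m =
  cong₂ _∧_ (all-range1-cong m (≗[1,suc]⇒≗[1,] m e)) (e (suc m) (s≤s z≤n) ℕₚ.≤-refl)

countB-range1-cong : ∀ {p q} m → p ≗[1, m ] q → countB p (range1 m) ≡ countB q (range1 m)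
countB-range1-cong {p} {q} zero    e = ≡.refl
countB-range1-cong {p} {q} (suc m) e rewrite countB-range1-suc p m | countB-range1-suc q m =
  cong₂ ℕ._+_ (countB-range1-cong m (≗[1,suc]⇒≗[1,] m e)) (cong (λ b → if b then 1 else 0) (e (suc m) (s≤s z≤n) ℕₚ.≤-refl))

all-range1⁺ : ∀ (p : ℕ → Bool) m → T (all p (range1 m)) → ∀ k → 1 ≤ k → k ≤ m → T (p k)
all-range1⁺ p zero    t (suc k) a ()
all-range1⁺ p (suc m) t k a b rewrite all-range1-suc p m with ℕₚ.m≤n⇒m<n∨m≡n b
... | inj₁ k<1+m = all-range1⁺ p m (proj₁ (to T-∧ t)) k a (ℕₚ.≤-pred k<1+m)
... | inj₂ ≡.refl  = proj₂ (to (T-∧ {all p (range1 m)}) t)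

all-range1⁻ : ∀ (p : ℕ → Bool) m → (∀ k → 1 ≤ k → k ≤ m → T (p k)) → T (all p (range1 m))
all-range1⁻ p zero    h = tt
all-range1⁻ p (suc m) h rewrite all-range1-suc p m =
  from T-∧ (all-range1⁻ p m (λ k a b → h k a (ℕₚ.m≤n⇒m≤1+n b)) , h (suc m) (s≤s z≤n) ℕₚ.≤-refl)

nth-map-allFin-suc : ∀ {n} (f : Fin (suc n) → ℕ) j →
  nth (map f (allFin (suc n))) (suc j) ≡ nth (map (λ i → f (Fin.suc i)) (allFin n)) j
nth-map-allFin-suc f j = cong (λ l → nth l j)
  (≡.trans (Listₚ.map-tabulate Fin.suc f) (≡.sym (Listₚ.map-tabulate (λ i → i) (λ i → f (Fin.suc i)))))

nth-map-allFin : ∀ {n} (f : Fin n → ℕ) (i : Fin n) → nth (map f (allFin n)) (toℕ i) ≡ f i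
nth-map-allFin f Fin.zero    = ≡.refl
nth-map-allFin {suc n} f (Fin.suc i) = ≡.trans (nth-map-allFin-suc f (toℕ i)) (nth-map-allFin (λ k → f (Fin.suc k)) i)

nth-map-allFin-< : ∀ {n} (f : Fin n → ℕ) j (j<n : j < n) → nth (map f (allFin n)) j ≡ f (fromℕ< j<n)
nth-map-allFin-< f j j<n = ≡.trans (cong (nth (map f (allFin _))) (≡.sym (Finₚ.toℕ-fromℕ< j<n))) (nth-map-allFin f (fromℕ< j<n))

countB-cong : ∀ {a} {A : Set a} {p q : A → Bool} (xs : List A) → (∀ x → p x ≡ q x) → countB p xs ≡ countB q xs
countB-cong []       e = ≡.refl
countB-cong (x ∷ xs) e = cong₂ (λ b r → if b then suc r else r) (e x) (countB-cong xs e)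

countB-allFin-permute : ∀ {n} (p : Fin n → Bool) (π : Permutation′ n) →
  countB (λ i → p (π ⟨$⟩ˡ i)) (allFin n) ≡ countB p (allFin n)
countB-allFin-permute {n} p π = ≡.trans (countB-tabulate {n = n} (λ i → p (π ⟨$⟩ˡ i)) (λ i → i))
  (≡.trans (count-permute p (flip π)) (≡.sym (countB-tabulate p (λ i → i))))

insertAt-cong : ∀ {a} {A : Set a} {n} {xs ys : Fin n → A} (k : Fin (suc n)) (v : A) →
  (∀ j → xs j ≡ ys j) → ∀ j → insertAt xs k v j ≡ insertAt ys k v j
insertAt-cong Fin.zero v e Fin.zero    = ≡.refl
insertAt-cong Fin.zero v e (Fin.suc j) = e j
insertAt-cong {n = suc n} (Fin.suc k) v e Fin.zero    = e Fin.zero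
insertAt-cong {n = suc n} (Fin.suc k) v e (Fin.suc j) = insertAt-cong k v (λ i → e (Fin.suc i)) j

booleans : List Bool
booleans = false ∷ true ∷ []

hasExps-cong : ∀ {n N} {s s′ : Fin n → Fin N} (α : Fin N → ℕ) → (∀ i → s i ≡ s′ i) → hasExps s α ≡ hasExps s′ α
hasExps-cong {n} {N} α e = all-cong (allFin N) (λ v → cong (λ k → k ≡ᵇ α v)
  (countB-cong (allFin n) (λ j → cong (λ w → toℕ w ≡ᵇ toℕ v) (e j))))

hasExps-permute : ∀ {n N} (s : Fin n → Fin N) (α : Fin N → ℕ) (π : Permutation′ n) →
  hasExps (λ i → s (π ⟨$⟩ˡ i)) α ≡ hasExps s α
hasExps-permute {n} {N} s α π = all-cong (allFin N) (λ v → cong (λ k → k ≡ᵇ α v)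
  (countB-allFin-permute (λ j → toℕ (s j) ≡ᵇ toℕ v) π))

compatible : ∀ {N} → PM N → PM N → Bool → Bool
compatible x y asc =
  if asc then ltPM x y ∨ (eqPM x y ∧ not (proj₂ x)) else ltPM x y ∨ (eqPM x y ∧ proj₂ x)

-- isEnriched π f is definitionally enriched (toℕ ∘ π) (f ∘ π): the condition read along the chain.
enriched : ∀ {n N} → (Fin n → ℕ) → (Fin n → PM N) → Bool
enriched {n} ρ g =
  all (λ a → all (λ b → not (toℕ a <ᵇ toℕ b) ∨ compatible (g a) (g b) (ρ a <ᵇ ρ b)) (allFin n)) (allFin n)

Enriched : ∀ {n N} → (Fin n → ℕ) → (Fin n → PM N) → Set
Enriched ρ g = ∀ a b → toℕ a < toℕ b → T (compatible (g a) (g b) (ρ a <ᵇ ρ b))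

signFits : Bool → Bool → Bool
signFits asc neg = if asc then not neg else neg

signFits⇒≡ : ∀ asc neg → T (signFits asc neg) → asc ≡ not neg
signFits⇒≡ true  false _ = ≡.refl
signFits⇒≡ false true  _ = ≡.refl

≡⇒signFits : ∀ asc neg → asc ≡ not neg → T (signFits asc neg)
≡⇒signFits true  false _ = tt
≡⇒signFits false true  _ = tt

link-sound : ∀ {N} (x y : PM N) {c} → T (ltPM x y ∨ (eqPM x y ∧ c)) → key x < key y ⊎ (key x ≡ key y × T c)
link-sound x y t with to (T-∨ {ltPM x y}) t
... | inj₁ lt = inj₁ (ℕₚ.<ᵇ⇒< _ _ lt)
... | inj₂ eq = inj₂ (ℕₚ.≡ᵇ⇒≡ _ _ (proj₁ (to T-∧ eq)) , proj₂ (to (T-∧ {eqPM x y}) eq))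

compatible-sound : ∀ {N} (x y : PM N) asc → T (compatible x y asc) →
  key x < key y ⊎ (key x ≡ key y × T (signFits asc (proj₂ x)))
compatible-sound x y true  t = link-sound x y t
compatible-sound x y false t = link-sound x y t

compatible-< : ∀ {N} (x y : PM N) asc → key x < key y → T (compatible x y asc)
compatible-< x y true  p = from T-∨ (inj₁ (ℕₚ.<⇒<ᵇ p))
compatible-< x y false p = from T-∨ (inj₁ (ℕₚ.<⇒<ᵇ p))

compatible-≡ : ∀ {N} (x y : PM N) asc → key x ≡ key y → T (signFits asc (proj₂ x)) → T (compatible x y asc)
compatible-≡ x y true  e s = from (T-∨ {ltPM x y}) (inj₂ (from T-∧ (ℕₚ.≡⇒≡ᵇ _ _ e , s)))
compatible-≡ x y false e s = from (T-∨ {ltPM x y}) (inj₂ (from T-∧ (ℕₚ.≡⇒≡ᵇ _ _ e , s)))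

key-≡⇒sign-≡ : ∀ {N} (x y : PM N) → key x ≡ key y → proj₂ x ≡ proj₂ y
key-≡⇒sign-≡ (v , false) (w , false) e = ≡.refl
key-≡⇒sign-≡ (v , true)  (w , true)  e = ≡.refl
key-≡⇒sign-≡ (v , false) (w , true)  e = ⊥-elim (ℕₚ.even≢odd (toℕ w) (toℕ v)
  (≡.trans (≡.sym (ℕₚ.+-identityʳ _)) (≡.trans (≡.sym e) (ℕₚ.+-comm _ 1))))
key-≡⇒sign-≡ (v , true)  (w , false) e = ⊥-elim (ℕₚ.even≢odd (toℕ v) (toℕ w)
  (≡.trans (≡.sym (ℕₚ.+-identityʳ _)) (≡.trans e (ℕₚ.+-comm _ 1))))

-- Equal keys carry equal signs, so two equality links force the same ascent/descent type.
compatible-trans : ∀ {N} (x y z : PM N) (u v w : ℕ) →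
  T (compatible x y (u <ᵇ v)) → T (compatible y z (v <ᵇ w)) → T (compatible x z (u <ᵇ w))
compatible-trans x y z u v w xy yz with compatible-sound x y _ xy | compatible-sound y z _ yz
... | inj₁ p       | inj₁ q       = compatible-< x z _ (ℕₚ.<-trans p q)
... | inj₁ p       | inj₂ (q , _) = compatible-< x z _ (subst (key x <_) q p)
... | inj₂ (p , _) | inj₁ q       = compatible-< x z _ (subst (_< key z) (≡.sym p) q)
... | inj₂ (p , s₁) | inj₂ (q , s₂) = compatible-≡ x z _ (≡.trans p q) (≡⇒signFits _ _ (chain (proj₂ x) uv vw))
  where
  uv : (u <ᵇ v) ≡ not (proj₂ x)
  uv = signFits⇒≡ _ _ s₁
  vw : (v <ᵇ w) ≡ not (proj₂ x)
  vw = ≡.trans (signFits⇒≡ _ _ s₂) (cong not (≡.sym (key-≡⇒sign-≡ x y p)))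
  chain : ∀ b → (u <ᵇ v) ≡ not b → (v <ᵇ w) ≡ not b → (u <ᵇ w) ≡ not b
  chain false e₁ e₂ = <⇒<ᵇ≡true {u} {w} (ℕₚ.<-trans (<ᵇ≡true⇒< {u} {v} e₁) (<ᵇ≡true⇒< {v} {w} e₂))
  chain true  e₁ e₂ = ≤⇒<ᵇ≡false {u} {w} (ℕₚ.≤-trans (<ᵇ≡false⇒≥ {v} {w} e₂) (<ᵇ≡false⇒≥ {u} {v} e₁))

enriched⇒Enriched : ∀ {n N} (ρ : Fin n → ℕ) (g : Fin n → PM N) → T (enriched ρ g) → Enriched ρ g
enriched⇒Enriched ρ g t a b a<b =
  modus-ponens (all-tabulate⁺ _ _ (all-tabulate⁺ _ _ t a) b) (ℕₚ.<⇒<ᵇ a<b)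

Enriched⇒enriched : ∀ {n N} (ρ : Fin n → ℕ) (g : Fin n → PM N) → Enriched ρ g → T (enriched ρ g)
Enriched⇒enriched ρ g H = all-tabulate⁻ _ _ (λ a → all-tabulate⁻ _ _ (λ b → link a b))
  where
  link : ∀ a b → T (not (toℕ a <ᵇ toℕ b) ∨ compatible (g a) (g b) (ρ a <ᵇ ρ b))
  link a b with toℕ a <ᵇ toℕ b in a<b
  ... | false = tt
  ... | true  = H a b (<ᵇ≡true⇒< a<b)

enriched-cong : ∀ {n N} (ρ : Fin n → ℕ) {g h : Fin n → PM N} → (∀ i → g i ≡ h i) → enriched ρ g ≡ enriched ρ h
enriched-cong {n} ρ e = all-cong (allFin n) (λ a → all-cong (allFin n) (λ b →
  cong₂ (λ x y → not (toℕ a <ᵇ toℕ b) ∨ compatible x y (ρ a <ᵇ ρ b)) (e a) (e b)))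

enriched-singleton : ∀ {N} (ρ : Fin 1 → ℕ) (g : Fin 1 → PM N) → enriched ρ g ≡ true
enriched-singleton ρ g = T⇒≡true (Enriched⇒enriched ρ g (λ { Fin.zero Fin.zero () }))

-- By transitivity only adjacent positions need to be compared.
enriched-◃ : ∀ {m N} (ρ : Fin (suc (suc m)) → ℕ) (x : PM N) (g : Fin (suc m) → PM N) →
  enriched ρ (x ◃ g) ≡ enriched (λ a → ρ (Fin.suc a)) g ∧ compatible x (g Fin.zero) (ρ Fin.zero <ᵇ ρ (Fin.suc Fin.zero))
enriched-◃ {m} ρ x g = T-⇔⇒≡ split join
  where
  ρ′ : Fin (suc m) → ℕ
  ρ′ a = ρ (Fin.suc a)
  adjacent : Bool
  adjacent = compatible x (g Fin.zero) (ρ Fin.zero <ᵇ ρ (Fin.suc Fin.zero))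
  split : T (enriched ρ (x ◃ g)) → T (enriched ρ′ g ∧ adjacent)
  split t = from T-∧ (Enriched⇒enriched ρ′ g (λ a b a<b → H (Fin.suc a) (Fin.suc b) (s≤s a<b)) , H Fin.zero (Fin.suc Fin.zero) (s≤s z≤n))
    where
    H : Enriched ρ (x ◃ g)
    H = enriched⇒Enriched ρ (x ◃ g) t
  join : T (enriched ρ′ g ∧ adjacent) → T (enriched ρ (x ◃ g))
  join t = Enriched⇒enriched ρ (x ◃ g) H
    where
    tail : Enriched ρ′ g
    tail = enriched⇒Enriched ρ′ g (proj₁ (to T-∧ t))
    head : T adjacent
    head = proj₂ (to (T-∧ {enriched ρ′ g}) t)
    H : Enriched ρ (x ◃ g)
    H Fin.zero (Fin.suc Fin.zero)    _ = head
    H Fin.zero (Fin.suc (Fin.suc b)) _ =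
      compatible-trans x (g Fin.zero) (g (Fin.suc b)) (ρ Fin.zero) (ρ (Fin.suc Fin.zero)) (ρ (Fin.suc (Fin.suc b)))
        head (tail Fin.zero (Fin.suc b) (s≤s z≤n))
    H (Fin.suc a) (Fin.suc b) (s≤s a<b) = tail a b a<b

key-< : ∀ {N} (v w : Fin N) e e′ → toℕ v < toℕ w → key (v , e) < key (w , e′)
key-< v w e e′ v<w = ℕₚ.≤-trans (s≤s (key≤ e)) (ℕₚ.≤-trans (subst (_≤ 2 ℕ.* toℕ w) (double-suc (toℕ v)) (ℕₚ.*-monoʳ-≤ 2 v<w)) (ℕₚ.m≤m+n _ _))
  where
  double-suc : ∀ x → 2 ℕ.* suc x ≡ suc (2 ℕ.* x ℕ.+ 1)
  double-suc = solve-∀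
  key≤ : ∀ e → key (v , e) ≤ 2 ℕ.* toℕ v ℕ.+ 1
  key≤ true  = ℕₚ.+-monoʳ-≤ (2 ℕ.* toℕ v) z≤n
  key≤ false = ℕₚ.≤-refl

compatible-at-< : ∀ {N} (v w : Fin N) e e′ asc → toℕ v < toℕ w → compatible (v , e) (w , e′) asc ≡ true
compatible-at-< v w e e′ asc v<w = T⇒≡true (compatible-< (v , e) (w , e′) asc (key-< v w e e′ v<w))

compatible⇒≤ : ∀ {N} (v w : Fin N) e e′ asc → T (compatible (v , e) (w , e′) asc) → toℕ v ≤ toℕ w
compatible⇒≤ v w e e′ asc t = ℕₚ.≮⇒≥ (λ w<v → not-below (compatible-sound (v , e) (w , e′) asc t) (key-< w v e′ e w<v))
  where
  not-below : key (v , e) < key (w , e′) ⊎ (key (v , e) ≡ key (w , e′) × T (signFits asc e)) → key (w , e′) < key (v , e) → ⊥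
  not-below (inj₁ lt)      gt = ℕₚ.<-asym lt gt
  not-below (inj₂ (eq , _)) gt = ℕₚ.<-irrefl (≡.sym eq) gt

-- compatible on entries of equal absolute value; the signs e, e′ are true for negative entries.
equalLink : Bool → Bool → Bool → Bool
equalLink true  true  asc = not asc
equalLink true  false asc = true
equalLink false true  asc = false
equalLink false false asc = asc

compatible-at-≡ : ∀ {N} (v w : Fin N) e e′ asc → toℕ v ≡ toℕ w → compatible (v , e) (w , e′) asc ≡ equalLink e e′ asc
compatible-at-≡ v w e e′ asc v≡w with toℕ w | v≡w
... | _ | ≡.refl = table e e′ asc
  where
  k : ℕ
  k = 2 ℕ.* toℕ v
  irrefl : ∀ m → (m <ᵇ m) ≡ false
  irrefl m = ≤⇒<ᵇ≡false {m} {m} ℕₚ.≤-refl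
  refl′ : ∀ m → (m ≡ᵇ m) ≡ true
  refl′ m = ≡⇒≡ᵇ≡true {m} {m} ≡.refl
  neg<pos : (k ℕ.+ 0 <ᵇ k ℕ.+ 1) ≡ true
  neg<pos = <⇒<ᵇ≡true (ℕₚ.+-monoʳ-< k (s≤s z≤n))
  pos≮neg : (k ℕ.+ 1 <ᵇ k ℕ.+ 0) ≡ false
  pos≮neg = ≤⇒<ᵇ≡false (ℕₚ.+-monoʳ-≤ k z≤n)
  pos≢neg : (k ℕ.+ 1 ≡ᵇ k ℕ.+ 0) ≡ false
  pos≢neg with k ℕ.+ 1 ≡ᵇ k ℕ.+ 0 in eq
  ... | false = ≡.refl
  ... | true  = ⊥-elim (ℕₚ.m+1+n≢m k (≡.trans (≡ᵇ≡true⇒≡ eq) (ℕₚ.+-identityʳ k)))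
  table : ∀ e e′ asc → compatible (v , e) (v , e′) asc ≡ equalLink e e′ asc
  table true  true  true  rewrite irrefl (k ℕ.+ 0) | refl′ (k ℕ.+ 0) = ≡.refl
  table true  true  false rewrite irrefl (k ℕ.+ 0) | refl′ (k ℕ.+ 0) = ≡.refl
  table true  false true  rewrite neg<pos = ≡.refl
  table true  false false rewrite neg<pos = ≡.refl
  table false true  true  rewrite pos≮neg | pos≢neg = ≡.refl
  table false true  false rewrite pos≮neg | pos≢neg = ≡.refl
  table false false true  rewrite irrefl (k ℕ.+ 1) | refl′ (k ℕ.+ 1) = ≡.refl
  table false false false rewrite irrefl (k ℕ.+ 1) | refl′ (k ℕ.+ 1) = ≡.refl

Des-suc : ∀ {m} (π : Permutation′ (suc m)) j → j < m →
  Des π (suc j) ≡ not (nth (oneLine π) j <ᵇ nth (oneLine π) (suc j))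
Des-suc {m} π j j<m = ≡.trans (cong (λ z → z ∧ (nth (oneLine π) (suc j) <ᵇ nth (oneLine π) j)) (<⇒<ᵇ≡true j<m)) (<ᵇ-flip _ _ distinct)
  where
  ρ : Fin (suc m) → ℕ
  ρ a = toℕ (π ⟨$⟩ʳ a)
  j<1+m : j < suc m
  j<1+m = ℕₚ.m<n⇒m<1+n j<m
  distinct : nth (oneLine π) j ≢ nth (oneLine π) (suc j)
  distinct eq = ℕₚ.1+n≢n {j} (≡.sym (≡.trans (≡.sym (Finₚ.toℕ-fromℕ< j<1+m)) (≡.trans (cong toℕ same-position) (Finₚ.toℕ-fromℕ< (s≤s j<m)))))
    where
    same-value : ρ (fromℕ< j<1+m) ≡ ρ (fromℕ< (s≤s j<m))
    same-value = ≡.trans (≡.sym (nth-map-allFin-< ρ j j<1+m)) (≡.trans eq (nth-map-allFin-< ρ (suc j) (s≤s j<m)))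
    same-position : fromℕ< j<1+m ≡ fromℕ< (s≤s j<m)
    same-position = ≡.trans (≡.sym (inverseˡ π)) (≡.trans (cong (π ⟨$⟩ˡ_) (Finₚ.toℕ-injective same-value)) (inverseˡ π))

values : ∀ {n N} → (Fin n → Fin N) → List ℕ
values {n} s = map (λ j → toℕ (s j)) (allFin n)

nondecreasingOn : ∀ {n N} → ℕ → (Fin n → Fin N) → Bool
nondecreasingOn m s = all (λ j → nth (values s) (j ∸ 1) ≤ᵇ nth (values s) j) (range1 m)

nondecreasing : ∀ {n N} → (Fin n → Fin N) → Bool
nondecreasing {zero}        s = true
nondecreasing {suc zero}    s = true
nondecreasing {suc (suc n)} s = (toℕ (s Fin.zero) ≤ᵇ toℕ (s (Fin.suc Fin.zero))) ∧ nondecreasing (λ i → s (Fin.suc i))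

-- plateau s j: positions j and j+1 (1-indexed) carry equal values
plateau : ∀ {n N} → (Fin n → Fin N) → ℕ → Bool
plateau s j = nth (values s) (j ∸ 1) ≡ᵇ nth (values s) j

firstPlateau : ∀ {m N} → (Fin (suc (suc m)) → Fin N) → Bool
firstPlateau s = toℕ (s Fin.zero) ≡ᵇ toℕ (s (Fin.suc Fin.zero))

#distinct : ∀ {n N} → (Fin n → Fin N) → ℕ
#distinct {n} {N} s = countB (λ v → any (λ j → toℕ (s j) ≡ᵇ toℕ v) (allFin n)) (allFin N)

values-suc : ∀ {m N} (s : Fin (suc m) → Fin N) j → nth (values s) (suc j) ≡ nth (values (λ i → s (Fin.suc i))) j
values-suc s = nth-map-allFin-suc (λ i → toℕ (s i))

nondecreasingOn≡nondecreasing : ∀ {N} m (s : Fin (suc m) → Fin N) → nondecreasingOn m s ≡ nondecreasing s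
nondecreasingOn≡nondecreasing zero    s = ≡.refl
nondecreasingOn≡nondecreasing (suc m) s =
  ≡.trans (all-range1-suc-front _ m)
        (cong ((toℕ (s Fin.zero) ≤ᵇ toℕ (s (Fin.suc Fin.zero))) ∧_)
              (≡.trans (all-range1-cong m shift) (nondecreasingOn≡nondecreasing m (λ i → s (Fin.suc i)))))
  where
  shift : (λ j → nth (values s) j ≤ᵇ nth (values s) (suc j)) ≗[1, m ]
          (λ j → nth (values (λ i → s (Fin.suc i))) (j ∸ 1) ≤ᵇ nth (values (λ i → s (Fin.suc i))) j)
  shift (suc j) _ _ = cong₂ _≤ᵇ_ (values-suc s j) (values-suc s (suc j))

nondecreasing-tail : ∀ {m N} (s : Fin (suc (suc m)) → Fin N) → T (nondecreasing s) → T (nondecreasing (λ i → s (Fin.suc i)))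
nondecreasing-tail s t = proj₂ (to (T-∧ {toℕ (s Fin.zero) ≤ᵇ toℕ (s (Fin.suc Fin.zero))}) t)

nondecreasing-head : ∀ {m N} (s : Fin (suc (suc m)) → Fin N) → T (nondecreasing s) → toℕ (s Fin.zero) ≤ toℕ (s (Fin.suc Fin.zero))
nondecreasing-head s t = ℕₚ.≤ᵇ⇒≤ _ _ (proj₁ (to T-∧ t))

nondecreasing-min : ∀ {n N} (s : Fin (suc n) → Fin N) → T (nondecreasing s) → ∀ j → toℕ (s Fin.zero) ≤ toℕ (s j)
nondecreasing-min s t Fin.zero = ℕₚ.≤-refl
nondecreasing-min {suc n} s t (Fin.suc j) =
  ℕₚ.≤-trans (nondecreasing-head s t) (nondecreasing-min (λ i → s (Fin.suc i)) (nondecreasing-tail s t) j)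

enriched⇒nondecreasing : ∀ {n N} (ρ : Fin n → ℕ) (s : Fin n → Fin N) (ε : Fin n → Bool) →
  T (enriched ρ (λ i → s i , ε i)) → T (nondecreasing s)
enriched⇒nondecreasing {zero}        ρ s ε t = tt
enriched⇒nondecreasing {suc zero}    ρ s ε t = tt
enriched⇒nondecreasing {suc (suc n)} {N} ρ s ε t =
  from T-∧ ( ℕₚ.≤⇒≤ᵇ (compatible⇒≤ (s Fin.zero) (s (Fin.suc Fin.zero)) (ε Fin.zero) (ε (Fin.suc Fin.zero)) (ρ Fin.zero <ᵇ ρ (Fin.suc Fin.zero))
                        (proj₂ (to (T-∧ {enriched ρ′ g′}) t′)))
           , enriched⇒nondecreasing ρ′ (λ i → s (Fin.suc i)) (λ i → ε (Fin.suc i)) (proj₁ (to T-∧ t′)))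
  where
  ρ′ : Fin (suc n) → ℕ
  ρ′ a = ρ (Fin.suc a)
  g′ : Fin (suc n) → PM N
  g′ i = s (Fin.suc i) , ε (Fin.suc i)
  t′ : T (enriched ρ′ g′ ∧ compatible (s Fin.zero , ε Fin.zero) (g′ Fin.zero) (ρ Fin.zero <ᵇ ρ (Fin.suc Fin.zero)))
  t′ = subst T (≡.trans (enriched-cong ρ {g = λ i → s i , ε i} {h = (s Fin.zero , ε Fin.zero) ◃ g′} (∷-cong ≡.refl (λ _ → ≡.refl)))
                        (enriched-◃ ρ (s Fin.zero , ε Fin.zero) g′)) t

any-tabulate : ∀ {a} {A : Set a} {n} (p : A → Bool) (f : Fin n → A) → any p (tabulate f) ≡ any (λ i → p (f i)) (allFin n)
any-tabulate {n = zero}  p f = ≡.refl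
any-tabulate {n = suc n} p f = cong (p (f Fin.zero) ∨_)
  (≡.trans (any-tabulate p (λ i → f (Fin.suc i))) (≡.sym (any-tabulate (λ i → p (f i)) Fin.suc)))

any-allFin-false : ∀ {n} (p : Fin n → Bool) → (∀ j → p j ≡ false) → any p (allFin n) ≡ false
any-allFin-false {zero}  p e = ≡.refl
any-allFin-false {suc n} p e rewrite e Fin.zero =
  ≡.trans (any-tabulate p Fin.suc) (any-allFin-false (λ i → p (Fin.suc i)) (λ i → e (Fin.suc i)))

count-insert : ∀ {N} (p : Fin N → Bool) (w : Fin N) →
  count (λ v → (toℕ w ≡ᵇ toℕ v) ∨ p v) ≡ count p ℕ.+ (if p w then 0 else 1)
count-insert {suc N} p Fin.zero with p Fin.zero
... | true  = cong suc (≡.sym (ℕₚ.+-identityʳ _))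
... | false = ℕₚ.+-comm 1 _
count-insert {suc N} p (Fin.suc w) with p Fin.zero | count-insert (λ i → p (Fin.suc i)) w
... | true  | ih = cong suc ih
... | false | ih = ih

count-false : ∀ {N} → count {N} (λ _ → false) ≡ 0
count-false {zero}  = ≡.refl
count-false {suc N} = count-false {N}

#distinct-singleton : ∀ {N} (s : Fin 1 → Fin N) → #distinct s ≡ 1
#distinct-singleton {N} s =
  ≡.trans (countB-tabulate {n = N} (λ v → any (λ j → toℕ (s j) ≡ᵇ toℕ v) (allFin 1)) (λ v → v))
          (≡.trans (count-insert {N} (λ _ → false) (s Fin.zero)) (cong (ℕ._+ 1) (count-false {N})))

#distinct-◃ : ∀ {m N} (s : Fin (suc (suc m)) → Fin N) → T (nondecreasing s) →
  #distinct s ≡ #distinct (λ i → s (Fin.suc i)) ℕ.+ (if firstPlateau s then 0 else 1)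
#distinct-◃ {m} {N} s t =
  ≡.trans (countB-tabulate {n = N} occurs (λ v → v))
  (≡.trans (count-cong {N} {p = occurs} (λ v → cong ((toℕ (s Fin.zero) ≡ᵇ toℕ v) ∨_) (any-tabulate (λ j → toℕ (s j) ≡ᵇ toℕ v) Fin.suc)))
  (≡.trans (count-insert {N} inTail (s Fin.zero))
         (cong₂ ℕ._+_ (≡.sym (countB-tabulate {n = N} inTail (λ v → v))) (cong (λ b → if b then 0 else 1) head-inTail))))
  where
  s′ : Fin (suc m) → Fin N
  s′ i = s (Fin.suc i)
  occurs : Fin N → Bool
  occurs v = any (λ j → toℕ (s j) ≡ᵇ toℕ v) (allFin (suc (suc m)))
  inTail : Fin N → Bool
  inTail v = any (λ j → toℕ (s′ j) ≡ᵇ toℕ v) (allFin (suc m))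
  -- s₀ reoccurs in the tail only as s₁, since the tail is bounded below by s₁ ≥ s₀.
  head-inTail : inTail (s Fin.zero) ≡ firstPlateau s
  head-inTail with firstPlateau s in eq
  ... | true  rewrite ≡⇒≡ᵇ≡true {toℕ (s′ Fin.zero)} {toℕ (s Fin.zero)} (≡.sym (≡ᵇ≡true⇒≡ eq)) = ≡.refl
  ... | false = any-allFin-false _ not-s₀
    where
    s₀<s₁ : toℕ (s Fin.zero) < toℕ (s′ Fin.zero)
    s₀<s₁ = ℕₚ.≤∧≢⇒< (nondecreasing-head s t) (λ e → true≢false (≡.trans (≡.sym (≡⇒≡ᵇ≡true e)) eq))
    not-s₀ : ∀ j → (toℕ (s′ j) ≡ᵇ toℕ (s Fin.zero)) ≡ false
    not-s₀ j with toℕ (s′ j) ≡ᵇ toℕ (s Fin.zero) in e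
    ... | false = ≡.refl
    ... | true  = ⊥-elim (ℕₚ.<-irrefl (≡.sym (≡ᵇ≡true⇒≡ e))
                    (ℕₚ.<-≤-trans s₀<s₁ (nondecreasing-min s′ (nondecreasing-tail s t) j)))

firstLink : ∀ {m N} → (Fin (suc (suc m)) → Fin N) → Bool → Bool → Bool → Bool
firstLink s e e′ asc = if firstPlateau s then equalLink e e′ asc else true

compatible-firstLink : ∀ {m N} (s : Fin (suc (suc m)) → Fin N) e e′ asc → T (nondecreasing s) →
  compatible (s Fin.zero , e) (s (Fin.suc Fin.zero) , e′) asc ≡ firstLink s e e′ asc
compatible-firstLink s e e′ asc t with firstPlateau s in eq
... | true  = compatible-at-≡ (s Fin.zero) (s (Fin.suc Fin.zero)) e e′ asc (≡ᵇ≡true⇒≡ eq)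
... | false = compatible-at-< (s Fin.zero) (s (Fin.suc Fin.zero)) e e′ asc
                (ℕₚ.≤∧≢⇒< (nondecreasing-head s t) (λ e → true≢false (≡.trans (≡.sym (≡⇒≡ᵇ≡true e)) eq)))

ascent : ∀ {m} → (Fin (suc (suc m)) → ℕ) → Bool
ascent ρ = ρ Fin.zero <ᵇ ρ (Fin.suc Fin.zero)

plateauDescentFirst : ∀ {N} m → (Fin (suc m) → ℕ) → (Fin (suc m) → Fin N) → Bool
plateauDescentFirst zero    ρ s = false
plateauDescentFirst (suc m) ρ s = firstPlateau s ∧ not (ascent ρ)

Bounded : ℕ → Subset → Set
Bounded m S = ∀ k → k ≡ 0 ⊎ m < k → S k ≡ false

insertTop : ℕ → Bool → Subset → Subset
insertTop m a S = if a then (λ k → (k ≡ᵇ suc m) ∨ S k) else S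

Bounded-insertTop : ∀ m a S → Bounded m S → Bounded (suc m) (insertTop m a S)
Bounded-insertTop m false S bS k (inj₁ k≡0) = bS k (inj₁ k≡0)
Bounded-insertTop m false S bS k (inj₂ m<k) = bS k (inj₂ (ℕₚ.<-trans (ℕₚ.n<1+n m) m<k))
Bounded-insertTop m true  S bS _ (inj₁ ≡.refl) = bS 0 (inj₁ ≡.refl)
Bounded-insertTop m true  S bS k (inj₂ m<k) with k ≡ᵇ suc m in eq
... | true  = ⊥-elim (ℕₚ.<-irrefl (≡.sym (≡ᵇ≡true⇒≡ eq)) m<k)
... | false = bS k (inj₂ (ℕₚ.<-trans (ℕₚ.n<1+n m) m<k))

insertTop-below : ∀ m a S k → k ≤ m → insertTop m a S k ≡ S k
insertTop-below m false S k k≤m = ≡.refl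
insertTop-below m true  S k k≤m with k ≡ᵇ suc m in eq
... | true  = ⊥-elim (ℕₚ.<-irrefl (≡ᵇ≡true⇒≡ eq) (s≤s k≤m))
... | false = ≡.refl

insertTop-top : ∀ m a S → Bounded m S → insertTop m a S (suc m) ≡ a
insertTop-top m false S bS = bS (suc m) (inj₂ ℕₚ.≤-refl)
insertTop-top m true  S bS rewrite ≡⇒≡ᵇ≡true {m} {m} ≡.refl = ≡.refl

covered : ℕ → (ℕ → Bool) → Subset → Subset → Bool
covered m e J K = all (λ j → not (((J ∪ shiftDown K) ∪ K) j) ∨ e j) (range1 m)

-- The same condition with the (K-1)-part moved from position j-1 to position j.
coveredLocally : (ℕ → Bool) → Subset → Subset → ℕ → Bool
coveredLocally e J K j = (not (J j) ∨ e j) ∧ (not (K j) ∨ (e j ∧ ((j ≡ᵇ 1) ∨ e (j ∸ 1))))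

cover⇒local-first : Valid 5 λ a b c x y → not (not ((a ∨ b) ∨ c) ∨ x) ∨ ((not a ∨ x) ∧ (not c ∨ (x ∧ (true ∨ y))))
cover⇒local-first = valid-by-evaluation 5 _ tt

cover⇒local : Valid 7 λ a b c x a′ c′ y →
  not (not ((a ∨ b) ∨ c) ∨ x) ∨ (not (not ((a′ ∨ c) ∨ c′) ∨ y) ∨ ((not a ∨ x) ∧ (not c ∨ (x ∧ (false ∨ y)))))
cover⇒local = valid-by-evaluation 7 _ tt

local⇒cover : Valid 7 λ a b c x z a′ x′ →
  not ((not a ∨ x) ∧ (not c ∨ (x ∧ z))) ∨ (not ((not a′ ∨ x′) ∧ (not b ∨ (x′ ∧ (false ∨ x)))) ∨ (not ((a ∨ b) ∨ c) ∨ x))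
local⇒cover = valid-by-evaluation 7 _ tt

local⇒cover-last : Valid 4 λ a c x z → not ((not a ∨ x) ∧ (not c ∨ (x ∧ z))) ∨ (not ((a ∨ false) ∨ c) ∨ x)
local⇒cover-last = valid-by-evaluation 4 _ tt

covered-locally : ∀ m e J K → Bounded m K → covered m e J K ≡ all (coveredLocally e J K) (range1 m)
covered-locally m e J K bK = T-⇔⇒≡ fwd bwd
  where
  fwd : T (covered m e J K) → T (all (coveredLocally e J K) (range1 m))
  fwd t = all-range1⁻ _ m local
    where
    H : ∀ k → 1 ≤ k → k ≤ m → T (not (((J ∪ shiftDown K) ∪ K) k) ∨ e k)
    H = all-range1⁺ _ m t
    local : ∀ k → 1 ≤ k → k ≤ m → T (coveredLocally e J K k)
    local 1 1≤k k≤m = modus-ponens (cover⇒local-first (J 1) (K 2) (K 1) (e 1) (e 0)) (H 1 1≤k k≤m)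
    local (suc (suc k)) 1≤k k≤m = modus-ponens (modus-ponens (cover⇒local (J (2 ℕ.+ k)) (K (3 ℕ.+ k)) (K (2 ℕ.+ k)) (e (2 ℕ.+ k)) (J (suc k)) (K (suc k)) (e (suc k)))
      (H (2 ℕ.+ k) 1≤k k≤m)) (H (suc k) (s≤s z≤n) (ℕₚ.<⇒≤ k≤m))
  bwd : T (all (coveredLocally e J K) (range1 m)) → T (covered m e J K)
  bwd t = all-range1⁻ _ m cover
    where
    H : ∀ k → 1 ≤ k → k ≤ m → T (coveredLocally e J K k)
    H = all-range1⁺ _ m t
    cover : ∀ k → 1 ≤ k → k ≤ m → T (not (((J ∪ shiftDown K) ∪ K) k) ∨ e k)
    cover (suc k) 1≤k k≤m with ℕₚ.m≤n⇒m<n∨m≡n k≤m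
    ... | inj₁ k<m = modus-ponens (modus-ponens (local⇒cover (J (suc k)) (K (2 ℕ.+ k)) (K (suc k)) (e (suc k)) ((suc k ≡ᵇ 1) ∨ e k) (J (2 ℕ.+ k)) (e (2 ℕ.+ k)))
                       (H (suc k) 1≤k k≤m)) (H (2 ℕ.+ k) (s≤s z≤n) k<m)
    ... | inj₂ ≡.refl = subst (λ z → T (not ((J (suc k) ∨ z) ∨ K (suc k)) ∨ e (suc k))) (≡.sym (bK (2 ℕ.+ k) (inj₂ ℕₚ.≤-refl)))
                        (modus-ponens (local⇒cover-last (J (suc k)) (K (suc k)) (e (suc k)) ((suc k ≡ᵇ 1) ∨ e k)) (H (suc k) 1≤k k≤m))

-- The side conditions J ⊆ I, K ⊆ Peak(I), J ∩ K = ∅ together with the η-condition, at a single position j.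
admissible : Subset → (ℕ → Bool) → Bool → Bool → ℕ → Bool
admissible I e a b j = ((not a ∨ I j) ∧ ((not b ∨ Peak I j) ∧ not (a ∧ b))) ∧ ((not a ∨ e j) ∧ (not b ∨ (e j ∧ ((j ≡ᵇ 1) ∨ e (j ∸ 1)))))

termCondition : ℕ → Subset → (ℕ → Bool) → Subset → Subset → Bool
termCondition m I e J K = (subsetB m J I ∧ subsetB m K (Peak I) ∧ disjointB m J K) ∧ covered m e J K

termCondition-local : ∀ m I e J K → Bounded m K → termCondition m I e J K ≡ all (λ j → admissible I e (J j) (K j) j) (range1 m)
termCondition-local m I e J K bK =
  ≡.trans (cong₂ _∧_ (≡.trans (cong (subsetB m J I ∧_) (≡.sym (all-∧ _ _ (range1 m)))) (≡.sym (all-∧ _ _ (range1 m))))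
                   (covered-locally m e J K bK))
        (≡.sym (all-∧ _ _ (range1 m)))

card-insertTop : ∀ m b S → Bounded m S → card (suc m) (insertTop m b S) ≡ card m S ℕ.+ (if b then 1 else 0)
card-insertTop m b S bS = ≡.trans (countB-range1-suc (insertTop m b S) m)
  (cong₂ ℕ._+_ (countB-range1-cong m (λ k _ k≤m → insertTop-below m b S k k≤m))
               (cong (λ z → if z then 1 else 0) (insertTop-top m b S bS)))

-- admissible at position k+1, in terms of I(k+1), I(k), e(k+1), e(k) and [k = 0]
admissibleAt : Bool → Bool → Bool → Bool → Bool → Bool → Bool → Bool
admissibleAt Iⱼ Iₚ eⱼ eₚ o a b =
  ((not a ∨ Iⱼ) ∧ ((not b ∨ (Iⱼ ∧ not (true ∧ Iₚ) ∧ not o)) ∧ not (a ∧ b))) ∧ ((not a ∨ eⱼ) ∧ (not b ∨ (eⱼ ∧ (o ∨ eₚ))))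

admissibleAt-both : ∀ Iⱼ Iₚ eⱼ eₚ o → admissibleAt Iⱼ Iₚ eⱼ eₚ o true true ≡ false
admissibleAt-both = ≡-by-evaluation _ _ tt

admissibleAt-J : ∀ Iⱼ Iₚ eⱼ eₚ o → admissibleAt Iⱼ Iₚ eⱼ eₚ o true false ≡ eⱼ ∧ Iⱼ
admissibleAt-J = ≡-by-evaluation _ _ tt

admissibleAt-K : ∀ Iⱼ Iₚ eⱼ eₚ o → admissibleAt Iⱼ Iₚ eⱼ eₚ o false true ≡ (eⱼ ∧ Iⱼ) ∧ (not o ∧ (eₚ ∧ not Iₚ))
admissibleAt-K = ≡-by-evaluation _ _ tt

module _ {c ℓ : Level} (R : CommutativeRing c ℓ) where
  open CommutativeRing R hiding (zero)
  open Coeffs R using (sumR; pow; coeffL; coeffRHS)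
  open SetoidReasoning setoid
  open CommutativeSemigroupProperties +-commutativeSemigroup using () renaming (x∙yz≈y∙xz to +-x∙yz≈y∙xz)
  open CommutativeSemigroupProperties *-commutativeSemigroup using () renaming (interchange to *-interchange; x∙yz≈y∙xz to *-x∙yz≈y∙xz)

  ∑ : ∀ {a} {A : Set a} → List A → (A → Carrier) → Carrier
  ∑ xs F = sumR (map F xs)

  syntax ∑ xs (λ x → F) = ∑[ x ∈ xs ] F

  ∑-cong : ∀ {a} {A : Set a} (xs : List A) {F G : A → Carrier} → (∀ x → F x ≈ G x) → ∑ xs F ≈ ∑ xs G
  ∑-cong []       e = refl
  ∑-cong (x ∷ xs) e = +-cong (e x) (∑-cong xs e)

  ∑-++ : ∀ {a} {A : Set a} (xs ys : List A) (F : A → Carrier) → ∑ (xs ++ ys) F ≈ ∑ xs F + ∑ ys F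
  ∑-++ []       ys F = sym (+-identityˡ _)
  ∑-++ (x ∷ xs) ys F = trans (+-congˡ (∑-++ xs ys F)) (sym (+-assoc _ _ _))

  ∑-concatMap : ∀ {a b} {A : Set a} {B : Set b} (h : A → List B) (xs : List A) (F : B → Carrier) →
    ∑ (concatMap h xs) F ≈ ∑[ x ∈ xs ] ∑ (h x) F
  ∑-concatMap h []       F = refl
  ∑-concatMap h (x ∷ xs) F = trans (∑-++ (h x) (concatMap h xs) F) (+-congˡ (∑-concatMap h xs F))

  ∑-map : ∀ {a b} {A : Set a} {B : Set b} (g : A → B) (xs : List A) (F : B → Carrier) →
    ∑ (map g xs) F ≈ ∑[ x ∈ xs ] F (g x)
  ∑-map g []       F = refl
  ∑-map g (x ∷ xs) F = +-congˡ (∑-map g xs F)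

  ∑-distrib-+ : ∀ {a} {A : Set a} (xs : List A) (F G : A → Carrier) → ∑[ x ∈ xs ] (F x + G x) ≈ ∑ xs F + ∑ xs G
  ∑-distrib-+ []       F G = sym (+-identityˡ _)
  ∑-distrib-+ (x ∷ xs) F G = begin
    (F x + G x) + ∑[ y ∈ xs ] (F y + G y) ≈⟨ +-congˡ (∑-distrib-+ xs F G) ⟩
    (F x + G x) + (∑ xs F + ∑ xs G)        ≈⟨ +-assoc _ _ _ ⟩
    F x + (G x + (∑ xs F + ∑ xs G))        ≈⟨ +-congˡ (+-x∙yz≈y∙xz _ _ _) ⟩
    F x + (∑ xs F + (G x + ∑ xs G))        ≈⟨ sym (+-assoc _ _ _) ⟩
    (F x + ∑ xs F) + (G x + ∑ xs G)        ∎

  ∑-zero : ∀ {a} {A : Set a} (xs : List A) → ∑[ x ∈ xs ] 0# ≈ 0#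
  ∑-zero []       = refl
  ∑-zero (x ∷ xs) = trans (+-identityˡ _) (∑-zero xs)

  ∑-comm : ∀ {a b} {A : Set a} {B : Set b} (xs : List A) (ys : List B) (F : A → B → Carrier) →
    ∑[ x ∈ xs ] ∑[ y ∈ ys ] F x y ≈ ∑[ y ∈ ys ] ∑[ x ∈ xs ] F x y
  ∑-comm []       ys F = sym (∑-zero ys)
  ∑-comm (x ∷ xs) ys F = trans (+-congˡ (∑-comm xs ys F)) (sym (∑-distrib-+ ys (F x) (λ y → ∑[ x ∈ xs ] F x y)))

  *-distribˡ-∑ : ∀ {a} {A : Set a} (k : Carrier) (xs : List A) (F : A → Carrier) → k * ∑ xs F ≈ ∑[ x ∈ xs ] (k * F x)
  *-distribˡ-∑ k []       F = zeroʳ k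
  *-distribˡ-∑ k (x ∷ xs) F = trans (distribˡ k _ _) (+-congˡ (*-distribˡ-∑ k xs F))

  *-distribʳ-∑ : ∀ {a} {A : Set a} (k : Carrier) (xs : List A) (F : A → Carrier) → ∑ xs F * k ≈ ∑[ x ∈ xs ] (F x * k)
  *-distribʳ-∑ k xs F = trans (*-comm _ _) (trans (*-distribˡ-∑ k xs F) (∑-cong xs (λ x → *-comm _ _)))

  [_]_ : Bool → Carrier → Carrier
  [ b ] x = if b then x else 0#

  infixr 25 [_]_

  []-cong : ∀ {a b x y} → a ≡ b → x ≈ y → [ a ] x ≈ [ b ] y
  []-cong {true}  ≡.refl e = e
  []-cong {false} ≡.refl e = refl

  []-∧ : ∀ a b x → [ a ∧ b ] x ≈ [ b ] [ a ] x
  []-∧ true  true  x = refl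
  []-∧ true  false x = refl
  []-∧ false true  x = refl
  []-∧ false false x = refl

  []-*ʳ : ∀ b x y → x * [ b ] y ≈ [ b ] (x * y)
  []-*ʳ true  x y = refl
  []-*ʳ false x y = zeroʳ x

  []-∧-* : ∀ a b x y → [ a ∧ b ] (x * y) ≈ [ a ] x * [ b ] y
  []-∧-* true  true  x y = refl
  []-∧-* true  false x y = sym (zeroʳ _)
  []-∧-* false b     x y = sym (zeroˡ _)

  []-∑ : ∀ {a} {A : Set a} (b : Bool) (xs : List A) (F : A → Carrier) → [ b ] ∑ xs F ≈ ∑[ x ∈ xs ] [ b ] F x
  []-∑ true  xs F = refl
  []-∑ false xs F = sym (∑-zero xs)

  pow-cong : ∀ {x k l} → k ≡ l → pow x k ≈ pow x l
  pow-cong ≡.refl = refl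

  pow-+ : ∀ x k l → pow x (k ℕ.+ l) ≈ pow x k * pow x l
  pow-+ x zero    l = sym (*-identityˡ _)
  pow-+ x (suc k) l = trans (*-congˡ (pow-+ x k l)) (sym (*-assoc _ _ _))

  Respects≗ : ∀ {a} {A : Set a} {n} → ((Fin n → A) → Carrier) → Set (a ⊔ ℓ)
  Respects≗ F = ∀ {f g} → (∀ i → f i ≡ g i) → F f ≈ F g

  ∑-allFuns-suc : ∀ {a} {A : Set a} n (xs : List A) (F : (Fin (suc n) → A) → Carrier) → Respects≗ F →
    ∑ (allFuns (suc n) xs) F ≈ ∑[ x ∈ xs ] ∑[ g ∈ allFuns n xs ] F (x ◃ g)
  ∑-allFuns-suc n xs F resp = trans (∑-concatMap _ xs F) (∑-cong xs (λ x →
    trans (∑-map _ (allFuns n xs) F) (∑-cong (allFuns n xs) (λ g → resp (∷-cong ≡.refl (λ _ → ≡.refl))))))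

  ∑-allFuns-insertAt : ∀ {a} {A : Set a} n (xs : List A) (k : Fin (suc n)) (F : (Fin (suc n) → A) → Carrier) → Respects≗ F →
    ∑ (allFuns (suc n) xs) F ≈ ∑[ x ∈ xs ] ∑[ g ∈ allFuns n xs ] F (insertAt g k x)
  ∑-allFuns-insertAt n xs Fin.zero F resp =
    trans (∑-allFuns-suc n xs F resp) (∑-cong xs (λ x → ∑-cong (allFuns n xs) (λ g → resp (∷-cong ≡.refl (λ _ → ≡.refl)))))
  ∑-allFuns-insertAt (suc n) xs (Fin.suc k) F resp = begin
    ∑ (allFuns (suc (suc n)) xs) F
      ≈⟨ ∑-allFuns-suc (suc n) xs F resp ⟩
    ∑[ y ∈ xs ] ∑[ h ∈ allFuns (suc n) xs ] F (y ◃ h)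
      ≈⟨ ∑-cong xs (λ y → ∑-allFuns-insertAt n xs k (λ h → F (y ◃ h)) (λ e → resp (∷-cong ≡.refl e))) ⟩
    ∑[ y ∈ xs ] ∑[ x ∈ xs ] ∑[ g ∈ allFuns n xs ] F (y ◃ insertAt g k x)
      ≈⟨ ∑-comm xs xs _ ⟩
    ∑[ x ∈ xs ] ∑[ y ∈ xs ] ∑[ g ∈ allFuns n xs ] F (y ◃ insertAt g k x)
      ≈⟨ ∑-cong xs (λ x → sym (trans (∑-allFuns-suc n xs _ (λ e → resp (insertAt-cong (Fin.suc k) x e)))
             (∑-cong xs (λ y → ∑-cong (allFuns n xs) (λ g → resp (∷-cong ≡.refl (λ _ → ≡.refl))))))) ⟩
    ∑[ x ∈ xs ] ∑[ g ∈ allFuns (suc n) xs ] F (insertAt g (Fin.suc k) x) ∎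

  ∑-allFuns-permute : ∀ {a} {A : Set a} n (xs : List A) (σ : Permutation′ n) (F : (Fin n → A) → Carrier) → Respects≗ F →
    ∑[ f ∈ allFuns n xs ] F (λ i → f (σ ⟨$⟩ʳ i)) ≈ ∑ (allFuns n xs) F
  ∑-allFuns-permute zero    xs σ F resp = ∑-cong (allFuns zero xs) (λ f → resp {λ i → f (σ ⟨$⟩ʳ i)} {f} (λ ()))
  ∑-allFuns-permute (suc n) xs σ F resp = begin
    ∑[ f ∈ allFuns (suc n) xs ] F (λ i → f (σ ⟨$⟩ʳ i))
      ≈⟨ ∑-allFuns-insertAt n xs k _ (λ e → resp (λ i → e (σ ⟨$⟩ʳ i))) ⟩
    ∑[ x ∈ xs ] ∑[ g ∈ allFuns n xs ] F (λ i → insertAt g k x (σ ⟨$⟩ʳ i))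
      ≈⟨ ∑-cong xs (λ x → ∑-cong (allFuns n xs) (λ g → resp (∷-cong (insertAt-lookup g k x) (moved x g)))) ⟩
    ∑[ x ∈ xs ] ∑[ g ∈ allFuns n xs ] F (x ◃ (λ j → g (σ′ ⟨$⟩ʳ j)))
      ≈⟨ ∑-cong xs (λ x → ∑-allFuns-permute n xs σ′ (λ h → F (x ◃ h)) (λ e → resp (∷-cong ≡.refl e))) ⟩
    ∑[ x ∈ xs ] ∑[ g ∈ allFuns n xs ] F (x ◃ g)
      ≈⟨ sym (∑-allFuns-suc n xs F resp) ⟩
    ∑ (allFuns (suc n) xs) F ∎
    where
    k : Fin (suc n)
    k = σ ⟨$⟩ʳ Fin.zero
    σ′ : Permutation′ n
    σ′ = remove Fin.zero σ
    moved : ∀ x g j → insertAt g k x (σ ⟨$⟩ʳ Fin.suc j) ≡ g (σ′ ⟨$⟩ʳ j)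
    moved x g j = ≡.trans (cong (insertAt g k x) (punchIn-permute σ Fin.zero j)) (insertAt-punchIn g k x (σ′ ⟨$⟩ʳ j))

  ∑-allFuns-pairs : ∀ n N (F : (Fin n → PM N) → Carrier) → Respects≗ F →
    ∑ (allFuns n (allPM N)) F ≈ ∑[ s ∈ allFuns n (allFin N) ] ∑[ ε ∈ allFuns n booleans ] F (λ i → s i , ε i)
  ∑-allFuns-pairs zero    N F resp = trans (+-congʳ (resp (λ ()))) (sym (+-identityʳ _))
  ∑-allFuns-pairs (suc n) N F resp = begin
    ∑ (allFuns (suc n) (allPM N)) F
      ≈⟨ ∑-allFuns-suc n (allPM N) F resp ⟩
    ∑[ x ∈ allPM N ] ∑[ g ∈ allFuns n (allPM N) ] F (x ◃ g)
      ≈⟨ ∑-concatMap _ (allFin N) _ ⟩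
    ∑[ v ∈ allFin N ] ∑[ b ∈ booleans ] ∑[ g ∈ allFuns n (allPM N) ] F ((v , b) ◃ g)
      ≈⟨ ∑-cong (allFin N) (λ v → ∑-cong booleans (λ b → ∑-allFuns-pairs n N (λ g → F ((v , b) ◃ g)) (λ e → resp (∷-cong ≡.refl e)))) ⟩
    ∑[ v ∈ allFin N ] ∑[ b ∈ booleans ] ∑[ s ∈ allFuns n (allFin N) ] ∑[ ε ∈ allFuns n booleans ] F ((v , b) ◃ (λ i → s i , ε i))
      ≈⟨ ∑-cong (allFin N) (λ v → ∑-comm booleans (allFuns n (allFin N)) (λ b s → ∑[ ε ∈ allFuns n booleans ] F ((v , b) ◃ (λ i → s i , ε i)))) ⟩
    ∑[ v ∈ allFin N ] ∑[ s ∈ allFuns n (allFin N) ] ∑[ b ∈ booleans ] ∑[ ε ∈ allFuns n booleans ] F ((v , b) ◃ (λ i → s i , ε i))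
      ≈⟨ ∑-cong (allFin N) (λ v → ∑-cong (allFuns n (allFin N)) (λ s → sym
           (trans (∑-allFuns-suc n booleans (λ ε → F (λ i → (v ◃ s) i , ε i)) (λ e → resp (λ i → cong ((v ◃ s) i ,_) (e i))))
                  (∑-cong booleans (λ b → ∑-cong (allFuns n booleans) (λ ε →
                    resp {λ i → (v ◃ s) i , (b ◃ ε) i} {(v , b) ◃ (λ i → s i , ε i)} (∷-cong ≡.refl (λ _ → ≡.refl)))))))) ⟩
    ∑[ v ∈ allFin N ] ∑[ s ∈ allFuns n (allFin N) ] ∑[ ε ∈ allFuns (suc n) booleans ] F (λ i → (v ◃ s) i , ε i)
      ≈⟨ sym (∑-allFuns-suc n (allFin N) (λ s → ∑[ ε ∈ allFuns (suc n) booleans ] F (λ i → s i , ε i))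
               (λ e → ∑-cong (allFuns (suc n) booleans) (λ ε → resp (λ i → cong (_, ε i) (e i))))) ⟩
    ∑[ s ∈ allFuns (suc n) (allFin N) ] ∑[ ε ∈ allFuns (suc n) booleans ] F (λ i → s i , ε i) ∎

  module _ (q : Carrier) where

    signSum : ∀ {n N} → (Fin n → ℕ) → (Fin n → Fin N) → Carrier
    signSum {n} ρ s = ∑[ ε ∈ allFuns n booleans ] [ enriched ρ (λ i → s i , ε i) ] pow q (count ε)

    coeffL≈∑signSum : ∀ {n} (π : Permutation′ n) N (α : Fin N → ℕ) →
      coeffL q π N α ≈ ∑[ s ∈ allFuns n (allFin N) ] [ hasExps s α ] signSum (λ a → toℕ (π ⟨$⟩ʳ a)) s
    coeffL≈∑signSum {n} π N α = begin
      ∑ (allFuns n (allPM N)) F               ≈⟨ sym (∑-allFuns-permute n (allPM N) (flip π) F respF) ⟩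
      ∑[ g ∈ allFuns n (allPM N) ] F (λ i → g (π ⟨$⟩ˡ i)) ≈⟨ ∑-cong (allFuns n (allPM N)) unpermute ⟩
      ∑ (allFuns n (allPM N)) G               ≈⟨ ∑-allFuns-pairs n N G respG ⟩
      ∑[ s ∈ allFuns n (allFin N) ] ∑[ ε ∈ allFuns n booleans ] G (λ i → s i , ε i)
        ≈⟨ ∑-cong (allFuns n (allFin N)) (λ s → trans (∑-cong (allFuns n booleans) (λ ε → []-∧ (enriched ρ (λ i → s i , ε i)) (hasExps s α) (pow q (count ε))))
                                                     (sym ([]-∑ (hasExps s α) (allFuns n booleans) _))) ⟩
      ∑[ s ∈ allFuns n (allFin N) ] [ hasExps s α ] signSum ρ s ∎
      where
      ρ : Fin n → ℕ
      ρ a = toℕ (π ⟨$⟩ʳ a)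
      F : (Fin n → PM N) → Carrier
      F f = [ isEnriched π f ∧ hasExps (λ i → proj₁ (f i)) α ] pow q (countB (λ i → proj₂ (f i)) (allFin n))
      G : (Fin n → PM N) → Carrier
      G g = [ enriched ρ g ∧ hasExps (λ i → proj₁ (g i)) α ] pow q (count (λ i → proj₂ (g i)))
      respF : Respects≗ F
      respF e = []-cong (cong₂ _∧_ (enriched-cong ρ (λ a → e (π ⟨$⟩ʳ a))) (hasExps-cong α (λ i → cong proj₁ (e i))))
                        (pow-cong (countB-cong (allFin n) (λ i → cong proj₂ (e i))))
      respG : Respects≗ G
      respG e = []-cong (cong₂ _∧_ (enriched-cong ρ e) (hasExps-cong α (λ i → cong proj₁ (e i))))
                        (pow-cong (count-cong (λ i → cong proj₂ (e i))))
      unpermute : ∀ g → F (λ i → g (π ⟨$⟩ˡ i)) ≈ G g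
      unpermute g = []-cong (cong₂ _∧_ (enriched-cong ρ (λ a → cong g (inverseˡ π))) (hasExps-permute (λ i → proj₁ (g i)) α π))
                            (pow-cong (≡.trans (countB-allFin-permute (λ i → proj₂ (g i)) π) (countB-tabulate {n = n} (λ i → proj₂ (g i)) (λ i → i))))

    signSumFrom : ∀ {N} m → (Fin (suc m) → ℕ) → (Fin (suc m) → Fin N) → Bool → Carrier
    signSumFrom m ρ s e = ∑[ ε ∈ allFuns m booleans ] [ enriched ρ (λ i → s i , (e ◃ ε) i) ] pow q (count (e ◃ ε))

    signSum≈signSumFrom : ∀ {N} m (ρ : Fin (suc m) → ℕ) (s : Fin (suc m) → Fin N) →
      signSum ρ s ≈ signSumFrom m ρ s false + (signSumFrom m ρ s true + 0#)
    signSum≈signSumFrom m ρ s = ∑-allFuns-suc m booleans _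
      (λ e → []-cong (enriched-cong ρ (λ i → cong (s i ,_) (e i))) (pow-cong (count-cong e)))

    signWeight : Bool → Carrier
    signWeight e = pow q (if e then 1 else 0)

    pow-◃ : ∀ {n} e (ε : Fin n → Bool) → pow q (count (e ◃ ε)) ≈ signWeight e * pow q (count ε)
    pow-◃ true  ε = *-congʳ (sym (*-identityʳ q))
    pow-◃ false ε = sym (*-identityˡ _)

    signSumFrom-suc : ∀ {N} m (ρ : Fin (suc (suc m)) → ℕ) (s : Fin (suc (suc m)) → Fin N) e → T (nondecreasing s) →
      signSumFrom (suc m) ρ s e ≈
        signWeight e * ∑[ e′ ∈ booleans ] [ firstLink s e e′ (ascent ρ) ] signSumFrom m (λ a → ρ (Fin.suc a)) (λ a → s (Fin.suc a)) e′
    signSumFrom-suc {N} m ρ s e t = begin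
      ∑ (allFuns (suc m) booleans) H
        ≈⟨ ∑-cong (allFuns (suc m) booleans) peel ⟩
      ∑ (allFuns (suc m) booleans) H′
        ≈⟨ ∑-allFuns-suc m booleans H′ respH′ ⟩
      ∑[ e′ ∈ booleans ] ∑[ ε ∈ allFuns m booleans ] H′ (e′ ◃ ε)
        ≈⟨ ∑-cong booleans (λ e′ → trans (sym (*-distribˡ-∑ (signWeight e) (allFuns m booleans) (λ ε → [ link e′ ] tailWeight (e′ ◃ ε))))
                                         (*-congˡ (sym ([]-∑ (link e′) (allFuns m booleans) (λ ε → tailWeight (e′ ◃ ε)))))) ⟩
      ∑[ e′ ∈ booleans ] (signWeight e * [ link e′ ] signSumFrom m ρ′ s′ e′)
        ≈⟨ sym (*-distribˡ-∑ (signWeight e) booleans (λ e′ → [ link e′ ] signSumFrom m ρ′ s′ e′)) ⟩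
      signWeight e * ∑[ e′ ∈ booleans ] [ link e′ ] signSumFrom m ρ′ s′ e′ ∎
      where
      ρ′ : Fin (suc m) → ℕ
      ρ′ a = ρ (Fin.suc a)
      s′ : Fin (suc m) → Fin N
      s′ a = s (Fin.suc a)
      link : Bool → Bool
      link e′ = firstLink s e e′ (ascent ρ)
      tailWeight : (Fin (suc m) → Bool) → Carrier
      tailWeight ε = [ enriched ρ′ (λ i → s′ i , ε i) ] pow q (count ε)
      H : (Fin (suc m) → Bool) → Carrier
      H ε = [ enriched ρ (λ i → s i , (e ◃ ε) i) ] pow q (count (e ◃ ε))
      H′ : (Fin (suc m) → Bool) → Carrier
      H′ ε = signWeight e * [ link (ε Fin.zero) ] tailWeight ε
      respH′ : Respects≗ H′
      respH′ e = *-congˡ ([]-cong (cong link (e Fin.zero))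
                   ([]-cong (enriched-cong ρ′ (λ i → cong (s′ i ,_) (e i))) (pow-cong (count-cong e))))
      peel : ∀ ε → H ε ≈ H′ ε
      peel ε = begin
        H ε
          ≈⟨ []-cong (≡.trans (enriched-cong ρ {g = λ i → s i , (e ◃ ε) i} {h = (s Fin.zero , e) ◃ (λ i → s′ i , ε i)} (∷-cong ≡.refl (λ _ → ≡.refl)))
                     (≡.trans (enriched-◃ ρ (s Fin.zero , e) (λ i → s′ i , ε i))
                              (cong (enriched ρ′ (λ i → s′ i , ε i) ∧_) (compatible-firstLink s e (ε Fin.zero) (ascent ρ) t))))
                     (pow-◃ e ε) ⟩
        [ enriched ρ′ (λ i → s′ i , ε i) ∧ link (ε Fin.zero) ] (signWeight e * pow q (count ε))
          ≈⟨ []-∧ (enriched ρ′ (λ i → s′ i , ε i)) (link (ε Fin.zero)) (signWeight e * pow q (count ε)) ⟩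
        [ link (ε Fin.zero) ] [ enriched ρ′ (λ i → s′ i , ε i) ] (signWeight e * pow q (count ε))
          ≈⟨ []-cong ≡.refl (sym ([]-*ʳ (enriched ρ′ (λ i → s′ i , ε i)) (signWeight e) (pow q (count ε)))) ⟩
        [ link (ε Fin.zero) ] (signWeight e * tailWeight ε)
          ≈⟨ sym ([]-*ʳ (link (ε Fin.zero)) (signWeight e) (tailWeight ε)) ⟩
        H′ ε ∎

    -- b records whether the previous link was a plateau ascent; a plateau descent after it is impossible.
    plateauFactor : Bool → Bool → Bool → Carrier
    plateauFactor b E D = if E ∧ D then (if b then 0# else q) else 1#

    linkFactor : Bool → Bool → Bool → Carrier
    linkFactor b E D = if E then plateauFactor b true D else q + 1#

    linkProduct : ∀ {N} m → Bool → (Fin (suc m) → ℕ) → (Fin (suc m) → Fin N) → Carrier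
    linkProduct zero    b ρ s = 1#
    linkProduct (suc m) b ρ s =
      linkFactor b (firstPlateau s) (not (ascent ρ)) * linkProduct m (firstPlateau s ∧ ascent ρ) (λ a → ρ (Fin.suc a)) (λ a → s (Fin.suc a))

    linkProduct-true : ∀ {N} m (ρ : Fin (suc m) → ℕ) (s : Fin (suc m) → Fin N) →
      linkProduct m true ρ s ≈ [ not (plateauDescentFirst m ρ s) ] linkProduct m false ρ s
    linkProduct-true zero    ρ s = refl
    linkProduct-true (suc m) ρ s = after-ascent (firstPlateau s) (not (ascent ρ)) _
      where
      after-ascent : ∀ E D X → linkFactor true E D * X ≈ [ not (E ∧ D) ] (linkFactor false E D * X)
      after-ascent true  true  X = zeroˡ X
      after-ascent true  false X = refl
      after-ascent false D     X = refl

    -- A plateau descent as first link forces the first sign to be negative; otherwise both signs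
    -- are possible and a negative one costs q.
    startValue : Bool → Bool → Carrier → Carrier
    startValue ED false P = if ED then 0# else P
    startValue ED true  P = if ED then (q + 1#) * P else q * P

    startValue-sum : ∀ ED P → startValue ED false P + (startValue ED true P + 0#) ≈ (q + 1#) * P
    startValue-sum true  P = trans (+-identityˡ _) (+-identityʳ _)
    startValue-sum false P = begin
      P + (q * P + 0#)  ≈⟨ +-congˡ (+-identityʳ _) ⟩
      P + q * P         ≈⟨ +-comm _ _ ⟩
      q * P + P         ≈⟨ +-congˡ (sym (*-identityˡ P)) ⟩
      q * P + 1# * P    ≈⟨ sym (distribʳ P q 1#) ⟩
      (q + 1#) * P      ∎

    startValue-step : ∀ E c ED′ (W′ : Bool → Carrier) (P : Bool → Carrier) →
      (∀ e′ → W′ e′ ≈ startValue ED′ e′ (P false)) → P true ≈ [ not ED′ ] P false → ∀ e →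
      signWeight e * ∑[ e′ ∈ booleans ] [ if E then equalLink e e′ c else true ] W′ e′
        ≈ startValue (E ∧ not c) e (linkFactor false E (not c) * P (E ∧ c))
    startValue-step E c ED′ W′ P IH P-true = go E c
      where
      both : W′ false + (W′ true + 0#) ≈ (q + 1#) * P false
      both = trans (+-cong (IH false) (+-congʳ (IH true))) (startValue-sum ED′ (P false))
      positive : W′ false ≈ P true
      positive = trans (IH false) (lemma ED′ P-true)
        where
        lemma : ∀ b → P true ≈ [ not b ] P false → startValue b false (P false) ≈ P true
        lemma true  h = sym h
        lemma false h = sym h
      go : ∀ E c e → signWeight e * ∑[ e′ ∈ booleans ] [ if E then equalLink e e′ c else true ] W′ e′
                     ≈ startValue (E ∧ not c) e (linkFactor false E (not c) * P (E ∧ c))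
      go false c     true  = trans (*-congʳ (*-identityʳ q)) (*-congˡ both)
      go false c     false = trans (*-identityˡ _) both
      go true  true  true  = trans (*-congʳ (*-identityʳ q)) (*-congˡ (trans (+-congˡ (+-identityˡ 0#)) (trans (+-identityʳ _) (trans positive (sym (*-identityˡ _))))))
      go true  true  false = trans (*-identityˡ _) (trans (+-congˡ (+-identityˡ 0#)) (trans (+-identityʳ _) (trans positive (sym (*-identityˡ _)))))
      go true  false true  = trans (*-congʳ (*-identityʳ q)) (trans (*-congˡ both) (*-x∙yz≈y∙xz q (q + 1#) (P false)))
      go true  false false = trans (*-identityˡ _) (trans (+-identityˡ _) (+-identityˡ _))

    signSumFrom≈startValue : ∀ {N} m (ρ : Fin (suc m) → ℕ) (s : Fin (suc m) → Fin N) → T (nondecreasing s) →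
      ∀ e → signSumFrom m ρ s e ≈ startValue (plateauDescentFirst m ρ s) e (linkProduct m false ρ s)
    signSumFrom≈startValue zero ρ s t e =
      trans (+-identityʳ _) ([]-cong (enriched-singleton ρ (λ i → s i , (e ◃ (λ ())) i)) (singleton e))
      where
      singleton : ∀ e → pow q (count {1} (e ◃ (λ ()))) ≈ startValue false e 1#
      singleton true  = refl
      singleton false = refl
    signSumFrom≈startValue {N} (suc m) ρ s t e =
      trans (signSumFrom-suc m ρ s e t)
            (startValue-step (firstPlateau s) (ascent ρ) (plateauDescentFirst m ρ′ s′) (signSumFrom m ρ′ s′) (λ b → linkProduct m b ρ′ s′)
               (signSumFrom≈startValue m ρ′ s′ (nondecreasing-tail s t)) (linkProduct-true m ρ′ s′) e)
      where
      ρ′ : Fin (suc m) → ℕ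
      ρ′ a = ρ (Fin.suc a)
      s′ : Fin (suc m) → Fin N
      s′ a = s (Fin.suc a)

    signSum-nondecreasing : ∀ {N} m (ρ : Fin (suc m) → ℕ) (s : Fin (suc m) → Fin N) → T (nondecreasing s) →
      signSum ρ s ≈ (q + 1#) * linkProduct m false ρ s
    signSum-nondecreasing m ρ s t =
      trans (signSum≈signSumFrom m ρ s)
            (trans (+-cong (signSumFrom≈startValue m ρ s t false) (+-congʳ (signSumFrom≈startValue m ρ s t true)))
                   (startValue-sum (plateauDescentFirst m ρ s) (linkProduct m false ρ s)))

    signSum-not-nondecreasing : ∀ {n N} (ρ : Fin n → ℕ) (s : Fin n → Fin N) → nondecreasing s ≡ false → signSum ρ s ≈ 0#
    signSum-not-nondecreasing {n} ρ s nd =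
      trans (∑-cong (allFuns n booleans) (λ ε → []-cong (not-enriched ε) refl)) (∑-zero (allFuns n booleans))
      where
      not-enriched : ∀ ε → enriched ρ (λ i → s i , ε i) ≡ false
      not-enriched ε = ¬T⇒≡false (λ t → subst T nd (enriched⇒nondecreasing ρ s ε t))

    newValueFactor : Bool → Carrier
    newValueFactor E = if E then 1# else q + 1#

    newValueProduct : ∀ {N} m → (Fin (suc m) → Fin N) → Carrier
    newValueProduct zero    s = 1#
    newValueProduct (suc m) s = newValueFactor (firstPlateau s) * newValueProduct m (λ a → s (Fin.suc a))

    plateauProduct : ∀ {N} m → Bool → (Fin (suc m) → ℕ) → (Fin (suc m) → Fin N) → Carrier
    plateauProduct zero    b ρ s = 1#
    plateauProduct (suc m) b ρ s =
      plateauFactor b (firstPlateau s) (not (ascent ρ)) * plateauProduct m (firstPlateau s ∧ ascent ρ) (λ a → ρ (Fin.suc a)) (λ a → s (Fin.suc a))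

    linkProduct≈newValue*plateau : ∀ {N} m b (ρ : Fin (suc m) → ℕ) (s : Fin (suc m) → Fin N) →
      linkProduct m b ρ s ≈ newValueProduct m s * plateauProduct m b ρ s
    linkProduct≈newValue*plateau zero    b ρ s = sym (*-identityˡ _)
    linkProduct≈newValue*plateau (suc m) b ρ s =
      trans (*-cong (linkFactor-split b (firstPlateau s) (not (ascent ρ))) (linkProduct≈newValue*plateau m _ _ _)) (*-interchange _ _ _ _)
      where
      linkFactor-split : ∀ b E D → linkFactor b E D ≈ newValueFactor E * plateauFactor b E D
      linkFactor-split b true  D = sym (*-identityˡ _)
      linkFactor-split b false D = sym (*-identityʳ _)

    pow-#distinct : ∀ {N} m (s : Fin (suc m) → Fin N) → T (nondecreasing s) → pow (q + 1#) (#distinct s) ≈ (q + 1#) * newValueProduct m s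
    pow-#distinct zero    s t = pow-cong (#distinct-singleton s)
    pow-#distinct {N} (suc m) s t = begin
      pow (q + 1#) (#distinct s)
        ≈⟨ pow-cong (#distinct-◃ s t) ⟩
      pow (q + 1#) (#distinct s′ ℕ.+ (if firstPlateau s then 0 else 1))
        ≈⟨ pow-+ (q + 1#) (#distinct s′) _ ⟩
      pow (q + 1#) (#distinct s′) * pow (q + 1#) (if firstPlateau s then 0 else 1)
        ≈⟨ *-cong (pow-#distinct m s′ (nondecreasing-tail s t)) (newValue (firstPlateau s)) ⟩
      ((q + 1#) * newValueProduct m s′) * newValueFactor (firstPlateau s)
        ≈⟨ trans (*-assoc _ _ _) (*-congˡ (*-comm _ _)) ⟩
      (q + 1#) * newValueProduct (suc m) s ∎
      where
      s′ : Fin (suc m) → Fin N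
      s′ a = s (Fin.suc a)
      newValue : ∀ E → pow (q + 1#) (if E then 0 else 1) ≈ newValueFactor E
      newValue true  = refl
      newValue false = *-identityʳ _

    ∑-subsets-suc : ∀ m (F : Subset → Carrier) → ∑ subsetsOf[ suc m ] F ≈ ∑[ S ∈ subsetsOf[ m ] ] ∑[ a ∈ booleans ] F (insertTop m a S)
    ∑-subsets-suc m F = ∑-concatMap _ subsetsOf[ m ] F

    ∑-subsets-cong : ∀ m {F G : Subset → Carrier} → (∀ S → Bounded m S → F S ≈ G S) → ∑ subsetsOf[ m ] F ≈ ∑ subsetsOf[ m ] G
    ∑-subsets-cong zero    e = +-congʳ (e _ (λ k _ → ≡.refl))
    ∑-subsets-cong (suc m) {F} {G} e = begin
      ∑ subsetsOf[ suc m ] F                                   ≈⟨ ∑-subsets-suc m F ⟩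
      ∑[ S ∈ subsetsOf[ m ] ] ∑[ a ∈ booleans ] F (insertTop m a S)
        ≈⟨ ∑-subsets-cong m (λ S bS → ∑-cong booleans (λ a → e (insertTop m a S) (Bounded-insertTop m a S bS))) ⟩
      ∑[ S ∈ subsetsOf[ m ] ] ∑[ a ∈ booleans ] G (insertTop m a S) ≈⟨ sym (∑-subsets-suc m G) ⟩
      ∑ subsetsOf[ suc m ] G                                   ∎

    indicatorPow : Carrier → Bool → Carrier
    indicatorPow x b = pow x (if b then 1 else 0)

    term : ℕ → Subset → (ℕ → Bool) → Subset → Subset → Carrier
    term m I e J K = [ all (λ j → admissible I e (J j) (K j) j) (range1 m) ] (pow (- q) (card m K) * pow (q - 1#) (card m J))

    localSum : Subset → (ℕ → Bool) → ℕ → Carrier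
    localSum I e j = ∑[ a ∈ booleans ] ∑[ b ∈ booleans ] [ admissible I e a b j ] (indicatorPow (- q) b * indicatorPow (q - 1#) a)

    subsetSum : ℕ → Subset → (ℕ → Bool) → Carrier
    subsetSum m I e = ∑[ J ∈ subsetsOf[ m ] ] ∑[ K ∈ subsetsOf[ m ] ] term m I e J K

    ∏[1,_] : ℕ → (ℕ → Carrier) → Carrier
    ∏[1, zero  ] g = 1#
    ∏[1, suc m ] g = ∏[1, m ] g * g (suc m)

    term-insertTop : ∀ m I e J K a b → Bounded m J → Bounded m K →
      term (suc m) I e (insertTop m a J) (insertTop m b K) ≈ term m I e J K * [ admissible I e a b (suc m) ] (indicatorPow (- q) b * indicatorPow (q - 1#) a)
    term-insertTop m I e J K a b bJ bK = begin
      term (suc m) I e (insertTop m a J) (insertTop m b K)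
        ≈⟨ []-cong (≡.trans (all-range1-suc _ m)
                     (cong₂ _∧_ (all-range1-cong m (λ k _ k≤m → cong₂ (λ u v → admissible I e u v k) (insertTop-below m a J k k≤m) (insertTop-below m b K k k≤m)))
                                (cong₂ (λ u v → admissible I e u v (suc m)) (insertTop-top m a J bJ) (insertTop-top m b K bK))))
                   (*-cong (trans (pow-cong (card-insertTop m b K bK)) (pow-+ (- q) (card m K) _))
                           (trans (pow-cong (card-insertTop m a J bJ)) (pow-+ (q - 1#) (card m J) _))) ⟩
      [ old ∧ new ] ((pow (- q) (card m K) * indicatorPow (- q) b) * (pow (q - 1#) (card m J) * indicatorPow (q - 1#) a))
        ≈⟨ []-cong ≡.refl (*-interchange _ _ _ _) ⟩
      [ old ∧ new ] ((pow (- q) (card m K) * pow (q - 1#) (card m J)) * (indicatorPow (- q) b * indicatorPow (q - 1#) a))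
        ≈⟨ []-∧-* old new _ _ ⟩
      term m I e J K * [ new ] (indicatorPow (- q) b * indicatorPow (q - 1#) a) ∎
      where
      old : Bool
      old = all (λ j → admissible I e (J j) (K j) j) (range1 m)
      new : Bool
      new = admissible I e a b (suc m)

    subsetSum-suc : ∀ m I e → subsetSum (suc m) I e ≈ subsetSum m I e * localSum I e (suc m)
    subsetSum-suc m I e = begin
      subsetSum (suc m) I e
        ≈⟨ ∑-subsets-suc m (λ J → ∑[ K ∈ subsetsOf[ suc m ] ] term (suc m) I e J K) ⟩
      ∑[ J ∈ subsetsOf[ m ] ] ∑[ a ∈ booleans ] ∑[ K ∈ subsetsOf[ suc m ] ] term (suc m) I e (insertTop m a J) K
        ≈⟨ ∑-cong subsetsOf[ m ] (λ J → ∑-cong booleans (λ a → ∑-subsets-suc m (term (suc m) I e (insertTop m a J)))) ⟩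
      ∑[ J ∈ subsetsOf[ m ] ] ∑[ a ∈ booleans ] ∑[ K ∈ subsetsOf[ m ] ] ∑[ b ∈ booleans ] term (suc m) I e (insertTop m a J) (insertTop m b K)
        ≈⟨ ∑-subsets-cong m (λ J bJ → ∑-cong booleans (λ a → ∑-subsets-cong m (λ K bK → ∑-cong booleans (λ b → term-insertTop m I e J K a b bJ bK)))) ⟩
      ∑[ J ∈ subsetsOf[ m ] ] ∑[ a ∈ booleans ] ∑[ K ∈ subsetsOf[ m ] ] ∑[ b ∈ booleans ] (term m I e J K * y a b)
        ≈⟨ ∑-cong subsetsOf[ m ] (λ J → ∑-comm booleans subsetsOf[ m ] (λ a K → ∑[ b ∈ booleans ] (term m I e J K * y a b))) ⟩
      ∑[ J ∈ subsetsOf[ m ] ] ∑[ K ∈ subsetsOf[ m ] ] ∑[ a ∈ booleans ] ∑[ b ∈ booleans ] (term m I e J K * y a b)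
        ≈⟨ ∑-cong subsetsOf[ m ] (λ J → ∑-cong subsetsOf[ m ] (λ K →
             trans (∑-cong booleans (λ a → sym (*-distribˡ-∑ (term m I e J K) booleans (y a))))
                   (sym (*-distribˡ-∑ (term m I e J K) booleans (λ a → ∑ booleans (y a)))))) ⟩
      ∑[ J ∈ subsetsOf[ m ] ] ∑[ K ∈ subsetsOf[ m ] ] (term m I e J K * localSum I e (suc m))
        ≈⟨ trans (∑-cong subsetsOf[ m ] (λ J → sym (*-distribʳ-∑ (localSum I e (suc m)) subsetsOf[ m ] (term m I e J))))
                 (sym (*-distribʳ-∑ (localSum I e (suc m)) subsetsOf[ m ] (λ J → ∑ subsetsOf[ m ] (term m I e J)))) ⟩
      subsetSum m I e * localSum I e (suc m) ∎
      where
      y : Bool → Bool → Carrier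
      y a b = [ admissible I e a b (suc m) ] (indicatorPow (- q) b * indicatorPow (q - 1#) a)

    subsetSum-∏ : ∀ m I e → subsetSum m I e ≈ ∏[1, m ] (localSum I e)
    subsetSum-∏ zero    I e = trans (+-identityʳ _) (trans (+-identityʳ _) (*-identityʳ _))
    subsetSum-∏ (suc m) I e = trans (subsetSum-suc m I e) (*-congʳ (subsetSum-∏ m I e))

    []-shuffle : ∀ c nd ac h w d → [ c ] (w * [ nd ∧ (ac ∧ h) ] d) ≈ [ h ] [ nd ] (d * [ c ∧ ac ] w)
    []-shuffle false nd    ac    h     w d = sym (trans ([]-cong {h} ≡.refl ([]-cong {nd} ≡.refl (zeroʳ d))) (zeros nd h))
      where
      zeros : ∀ nd h → [ h ] [ nd ] 0# ≈ 0#
      zeros true  true  = refl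
      zeros true  false = refl
      zeros false true  = refl
      zeros false false = refl
    []-shuffle true  false ac    h     w d = trans (zeroʳ w) (sym (zeros h))
      where
      zeros : ∀ h → [ h ] [ false ] (d * [ ac ] w) ≈ 0#
      zeros true  = refl
      zeros false = refl
    []-shuffle true  true  false h     w d = trans (zeroʳ w) (sym (zeros h))
      where
      zeros : ∀ h → [ h ] [ true ] (d * 0#) ≈ 0#
      zeros true  = zeroʳ d
      zeros false = refl
    []-shuffle true  true  true  true  w d = *-comm w d
    []-shuffle true  true  true  false w d = zeroʳ w

    coeffRHS≈∑subsetSum : ∀ n I N (α : Fin N → ℕ) →
      coeffRHS q n I N α ≈
        ∑[ s ∈ allFuns n (allFin N) ] [ hasExps s α ] [ nondecreasingOn (n ∸ 1) s ] (pow (q + 1#) (#distinct s) * subsetSum (n ∸ 1) I (plateau s))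
    coeffRHS≈∑subsetSum n I N α = begin
      ∑[ J ∈ S ] ∑[ K ∈ S ] [ side J K ] (weight J K * ∑[ s ∈ seqs ] [ nd s ∧ (covered m (plateau s) J K ∧ h s) ] d s)
        ≈⟨ ∑-cong S (λ J → ∑-cong S (λ K → trans ([]-cong ≡.refl (*-distribˡ-∑ (weight J K) seqs _)) ([]-∑ (side J K) seqs _))) ⟩
      ∑[ J ∈ S ] ∑[ K ∈ S ] ∑[ s ∈ seqs ] [ side J K ] (weight J K * [ nd s ∧ (covered m (plateau s) J K ∧ h s) ] d s)
        ≈⟨ trans (∑-cong S (λ J → ∑-comm S seqs _)) (∑-comm S seqs _) ⟩
      ∑[ s ∈ seqs ] ∑[ J ∈ S ] ∑[ K ∈ S ] [ side J K ] (weight J K * [ nd s ∧ (covered m (plateau s) J K ∧ h s) ] d s)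
        ≈⟨ ∑-cong seqs (λ s → ∑-cong S (λ J → ∑-cong S (λ K → []-shuffle (side J K) (nd s) (covered m (plateau s) J K) (h s) (weight J K) (d s)))) ⟩
      ∑[ s ∈ seqs ] ∑[ J ∈ S ] ∑[ K ∈ S ] [ h s ] [ nd s ] (d s * [ termCondition m I (plateau s) J K ] weight J K)
        ≈⟨ ∑-cong seqs pull-out ⟩
      ∑[ s ∈ seqs ] [ h s ] [ nd s ] (d s * subsetSum m I (plateau s)) ∎
      where
      m : ℕ
      m = n ∸ 1
      S : List Subset
      S = subsetsOf[ m ]
      seqs : List (Fin n → Fin N)
      seqs = allFuns n (allFin N)
      side : Subset → Subset → Bool
      side J K = subsetB m J I ∧ subsetB m K (Peak I) ∧ disjointB m J K
      weight : Subset → Subset → Carrier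
      weight J K = pow (- q) (card m K) * pow (q - 1#) (card m J)
      nd : (Fin n → Fin N) → Bool
      nd s = nondecreasingOn m s
      h : (Fin n → Fin N) → Bool
      h s = hasExps s α
      d : (Fin n → Fin N) → Carrier
      d s = pow (q + 1#) (#distinct s)
      pull : ∀ s (F : Subset → Carrier) → ∑[ K ∈ S ] [ h s ] [ nd s ] (d s * F K) ≈ [ h s ] [ nd s ] (d s * ∑ S F)
      pull s F = trans (sym ([]-∑ (h s) S _)) ([]-cong ≡.refl (trans (sym ([]-∑ (nd s) S _)) ([]-cong ≡.refl (sym (*-distribˡ-∑ (d s) S F)))))
      pull-out : ∀ s → ∑[ J ∈ S ] ∑[ K ∈ S ] [ h s ] [ nd s ] (d s * [ termCondition m I (plateau s) J K ] weight J K)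
                       ≈ [ h s ] [ nd s ] (d s * subsetSum m I (plateau s))
      pull-out s = begin
        ∑[ J ∈ S ] ∑[ K ∈ S ] [ h s ] [ nd s ] (d s * [ termCondition m I (plateau s) J K ] weight J K)
          ≈⟨ ∑-cong S (λ J → pull s (λ K → [ termCondition m I (plateau s) J K ] weight J K)) ⟩
        ∑[ J ∈ S ] [ h s ] [ nd s ] (d s * ∑[ K ∈ S ] [ termCondition m I (plateau s) J K ] weight J K)
          ≈⟨ pull s (λ J → ∑[ K ∈ S ] [ termCondition m I (plateau s) J K ] weight J K) ⟩
        [ h s ] [ nd s ] (d s * ∑[ J ∈ S ] ∑[ K ∈ S ] [ termCondition m I (plateau s) J K ] weight J K)
          ≈⟨ []-cong {h s} ≡.refl ([]-cong {nd s} ≡.refl (*-congˡ (∑-cong S (λ J → ∑-subsets-cong m (λ K bK →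
               []-cong (termCondition-local m I (plateau s) J K bK) refl))))) ⟩
        [ h s ] [ nd s ] (d s * subsetSum m I (plateau s)) ∎

    localValue : ∀ x p → 1# + ([ x ∧ p ] (- q) + [ x ] (q - 1#)) ≈ (if x then (if p then 0# else q) else 1#)
    localValue false p     = trans (+-congˡ (+-identityˡ 0#)) (+-identityʳ 1#)
    localValue true  false = begin
      1# + (0# + (q - 1#))  ≈⟨ +-congˡ (+-identityˡ _) ⟩
      1# + (q + - 1#)       ≈⟨ +-x∙yz≈y∙xz 1# q (- 1#) ⟩
      q + (1# + - 1#)       ≈⟨ +-congˡ (-‿inverseʳ 1#) ⟩
      q + 0#                ≈⟨ +-identityʳ q ⟩
      q                     ∎
    localValue true  true  = begin
      1# + (- q + (q + - 1#))   ≈⟨ +-congˡ (sym (+-assoc _ _ _)) ⟩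
      1# + ((- q + q) + - 1#)   ≈⟨ +-congˡ (+-congʳ (-‿inverseˡ q)) ⟩
      1# + (0# + - 1#)          ≈⟨ +-congˡ (+-identityˡ _) ⟩
      1# + - 1#                 ≈⟨ -‿inverseʳ 1# ⟩
      0#                        ∎

    localSum-suc : ∀ I e k → localSum I e (suc k) ≈ plateauFactor (not (k ≡ᵇ 0) ∧ (e k ∧ not (I k))) (e (suc k)) (I (suc k))
    localSum-suc I e k = begin
      (1# * 1# + ([ adm false true ] ((- q * 1#) * 1#) + 0#))
        + (([ adm true false ] (1# * ((q - 1#) * 1#)) + ([ adm true true ] ((- q * 1#) * ((q - 1#) * 1#)) + 0#)) + 0#)
        ≈⟨ +-cong (+-cong (*-identityˡ 1#) (trans (+-identityʳ _) ([]-cong (admissibleAt-K Iⱼ Iₚ eⱼ eₚ o) (trans (*-identityʳ _) (*-identityʳ _)))))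
                  (trans (+-identityʳ _) (+-cong ([]-cong (admissibleAt-J Iⱼ Iₚ eⱼ eₚ o) (trans (*-identityˡ _) (*-identityʳ _)))
                                                 (trans (+-identityʳ _) ([]-cong (admissibleAt-both Iⱼ Iₚ eⱼ eₚ o) refl)))) ⟩
      (1# + [ (eⱼ ∧ Iⱼ) ∧ b ] (- q)) + ([ eⱼ ∧ Iⱼ ] (q - 1#) + 0#)
        ≈⟨ trans (+-congˡ (+-identityʳ _)) (+-assoc _ _ _) ⟩
      1# + ([ (eⱼ ∧ Iⱼ) ∧ b ] (- q) + [ eⱼ ∧ Iⱼ ] (q - 1#))
        ≈⟨ localValue (eⱼ ∧ Iⱼ) b ⟩
      plateauFactor b eⱼ Iⱼ ∎
      where
      Iⱼ Iₚ eⱼ eₚ o b : Bool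
      Iⱼ = I (suc k)
      Iₚ = I k
      eⱼ = e (suc k)
      eₚ = e k
      o = k ≡ᵇ 0
      b = not o ∧ (eₚ ∧ not Iₚ)
      adm : Bool → Bool → Bool
      adm a b′ = admissible I e a b′ (suc k)

    ∏[_,+_] : ℕ → ℕ → (ℕ → Carrier) → Carrier
    ∏[ k ,+ zero  ] g = 1#
    ∏[ k ,+ suc m ] g = g k * ∏[ suc k ,+ m ] g

    ∏[,+]-snoc : ∀ k m g → ∏[ k ,+ suc m ] g ≈ ∏[ k ,+ m ] g * g (k ℕ.+ m)
    ∏[,+]-snoc k zero    g rewrite ℕₚ.+-identityʳ k = trans (*-identityʳ _) (sym (*-identityˡ _))
    ∏[,+]-snoc k (suc m) g rewrite ℕₚ.+-suc k m = trans (*-congˡ (∏[,+]-snoc (suc k) m g)) (sym (*-assoc _ _ _))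

    ∏[1,]≈∏[1,+] : ∀ m g → ∏[1, m ] g ≈ ∏[ 1 ,+ m ] g
    ∏[1,]≈∏[1,+] zero    g = refl
    ∏[1,]≈∏[1,+] (suc m) g = trans (*-congʳ (∏[1,]≈∏[1,+] m g)) (sym (∏[,+]-snoc 1 m g))

    plateauFactor-cong : ∀ {b b′ E E′ D D′} → b ≡ b′ → E ≡ E′ → D ≡ D′ → plateauFactor b E D ≈ plateauFactor b′ E′ D′
    plateauFactor-cong ≡.refl ≡.refl ≡.refl = refl

    ∏localSum≈plateauProduct : ∀ {N} m k b (ρ : Fin (suc m) → ℕ) (s : Fin (suc m) → Fin N) I e →
      (∀ j → j < m → e (suc k ℕ.+ j) ≡ (nth (values s) j ≡ᵇ nth (values s) (suc j))) →
      (∀ j → j < m → I (suc k ℕ.+ j) ≡ not (nth (map ρ (allFin (suc m))) j <ᵇ nth (map ρ (allFin (suc m))) (suc j))) →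
      b ≡ not (k ≡ᵇ 0) ∧ (e k ∧ not (I k)) →
      ∏[ suc k ,+ m ] (localSum I e) ≈ plateauProduct m b ρ s
    ∏localSum≈plateauProduct zero    k b ρ s I e eqs descents b≡ = refl
    ∏localSum≈plateauProduct {N} (suc m) k b ρ s I e eqs descents b≡ =
      *-cong (trans (localSum-suc I e k) (plateauFactor-cong (≡.sym b≡) e₀ I₀))
             (∏localSum≈plateauProduct m (suc k) _ ρ′ s′ I e eqs′ descents′ (cong₂ _∧_ (≡.sym e₀) (≡.trans (≡.sym (not-involutive _)) (cong not (≡.sym I₀)))))
      where
      ρ′ : Fin (suc m) → ℕ
      ρ′ a = ρ (Fin.suc a)
      s′ : Fin (suc m) → Fin N
      s′ a = s (Fin.suc a)
      e₀ : e (suc k) ≡ firstPlateau s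
      e₀ = ≡.trans (cong e (≡.sym (ℕₚ.+-identityʳ (suc k)))) (eqs 0 (s≤s z≤n))
      I₀ : I (suc k) ≡ not (ascent ρ)
      I₀ = ≡.trans (cong I (≡.sym (ℕₚ.+-identityʳ (suc k)))) (descents 0 (s≤s z≤n))
      eqs′ : ∀ j → j < m → e (suc (suc k) ℕ.+ j) ≡ (nth (values s′) j ≡ᵇ nth (values s′) (suc j))
      eqs′ j j<m = ≡.trans (cong e (≡.sym (ℕₚ.+-suc (suc k) j)))
                     (≡.trans (eqs (suc j) (s≤s j<m)) (cong₂ _≡ᵇ_ (values-suc s j) (values-suc s (suc j))))
      descents′ : ∀ j → j < m → I (suc (suc k) ℕ.+ j) ≡ not (nth (map ρ′ (allFin (suc m))) j <ᵇ nth (map ρ′ (allFin (suc m))) (suc j))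
      descents′ j j<m = ≡.trans (cong I (≡.sym (ℕₚ.+-suc (suc k) j)))
                          (≡.trans (descents (suc j) (s≤s j<m)) (cong not (cong₂ _<ᵇ_ (nth-map-allFin-suc ρ j) (nth-map-allFin-suc ρ (suc j)))))

    signSum≈subsetSum : ∀ {n N} (π : Permutation′ n) I → (∀ k → Des π k ≡ I k) → (s : Fin n → Fin N) →
      signSum (λ a → toℕ (π ⟨$⟩ʳ a)) s ≈ [ nondecreasingOn (n ∸ 1) s ] (pow (q + 1#) (#distinct s) * subsetSum (n ∸ 1) I (plateau s))
    signSum≈subsetSum {zero} {N} π I Des≡I s =
      trans (+-identityʳ 1#) (sym (trans (*-cong (pow-cong no-values) (subsetSum-∏ 0 I (plateau s))) (*-identityʳ 1#)))
      where
      no-values : #distinct s ≡ 0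
      no-values = ≡.trans (countB-tabulate {n = N} (λ _ → false) (λ v → v)) (count-false {N})
    signSum≈subsetSum {suc m} π I Des≡I s with nondecreasing s in nd
    ... | true = begin
      signSum ρ s                                                      ≈⟨ signSum-nondecreasing m ρ s (≡true⇒T nd) ⟩
      (q + 1#) * linkProduct m false ρ s                               ≈⟨ *-congˡ (linkProduct≈newValue*plateau m false ρ s) ⟩
      (q + 1#) * (newValueProduct m s * plateauProduct m false ρ s)   ≈⟨ sym (*-assoc _ _ _) ⟩
      ((q + 1#) * newValueProduct m s) * plateauProduct m false ρ s   ≈⟨ *-cong (sym (pow-#distinct m s (≡true⇒T nd))) (sym local-factors) ⟩
      pow (q + 1#) (#distinct s) * subsetSum m I (plateau s)          ≈⟨ []-cong (≡.sym (≡.trans (nondecreasingOn≡nondecreasing m s) nd)) refl ⟩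
      [ nondecreasingOn m s ] (pow (q + 1#) (#distinct s) * subsetSum m I (plateau s)) ∎
      where
      ρ : Fin (suc m) → ℕ
      ρ a = toℕ (π ⟨$⟩ʳ a)
      local-factors : subsetSum m I (plateau s) ≈ plateauProduct m false ρ s
      local-factors = trans (subsetSum-∏ m I (plateau s)) (trans (∏[1,]≈∏[1,+] m _)
        (∏localSum≈plateauProduct m 0 false ρ s I (plateau s) (λ j _ → ≡.refl) (λ j j<m → ≡.trans (≡.sym (Des≡I (suc j))) (Des-suc π j j<m)) ≡.refl))
    ... | false = trans (signSum-not-nondecreasing (λ a → toℕ (π ⟨$⟩ʳ a)) s nd)
                        (sym ([]-cong (≡.trans (nondecreasingOn≡nondecreasing m s) nd) refl))

    coeffL≈coeffRHS : ∀ n I (π : Permutation′ n) → (∀ k → Des π k ≡ I k) → ∀ N (α : Fin N → ℕ) →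
      coeffL q π N α ≈ coeffRHS q n I N α
    coeffL≈coeffRHS n I π Des≡I N α = begin
      coeffL q π N α
        ≈⟨ coeffL≈∑signSum π N α ⟩
      ∑[ s ∈ allFuns n (allFin N) ] [ hasExps s α ] signSum (λ a → toℕ (π ⟨$⟩ʳ a)) s
        ≈⟨ ∑-cong (allFuns n (allFin N)) (λ s → []-cong ≡.refl (signSum≈subsetSum π I Des≡I s)) ⟩
      ∑[ s ∈ allFuns n (allFin N) ] [ hasExps s α ] [ nondecreasingOn (n ∸ 1) s ] (pow (q + 1#) (#distinct s) * subsetSum (n ∸ 1) I (plateau s))
        ≈⟨ sym (coeffRHS≈∑subsetSum n I N α) ⟩
      coeffRHS q n I N α ∎

theorem4p2 : ∀ {c ℓ : Level} (R : CommutativeRing c ℓ) (q : CommutativeRing.Carrier R)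
    (n : ℕ) (I : Subset) → (∀ k → I k ≡ true → (1 ≤ k) × (k ≤ n ∸ 1))
    → (π : Permutation′ n) → (∀ k → Des π k ≡ I k)
    → (N : ℕ) (α : Fin N → ℕ)
    → CommutativeRing._≈_ R (Coeffs.coeffL R q π N α) (Coeffs.coeffRHS R q n I N α)
theorem4p2 R q n I _ π Des≡I N α = coeffL≈coeffRHS R q n I π Des≡I N α
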